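{- For any integers $k,s\ge 2$ and any real numbers $K,\varepsilon>0$ there exists a constant $C=C(k,s,K,\varepsilon)>0$ such that the following holds. Let $G$ be a graph on $n$ vertices which does not contain $K_{s,s}$ as a subgraph, and let $V(G)=A\cup B$ be a partition with at least $Cn^{1+1/k}$ edges between $A$ and $B$. Assume that the graph $G_1$ on $V(G)$ consisting of the edges between $A$ and $B$ is $K$-almost-regular. Then at least a $(1-\varepsilon)$-fraction of the alternating paths of length $k$ in $G$ are induced (in $G$).
   Context: A graph is $K$-almost-regular if its maximum degree is at most $K$ times its minimum degree. A path in $G$ is alternating if all of its edges go between $A$ and $B$; its length is its number of edges. A path is induced if the subgraph of $G$ induced on its vertex set is exactly the path.
   Formalization: The parameters K and ε range over the positive rationals rather than the positive reals. -}

module Defs where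

open import Data.Bool using (Bool; true; false; _∧_; not; if_then_else_)
open import Data.Nat using (ℕ; zero; suc; _≡ᵇ_; _<ᵇ_)
open import Data.Fin using (Fin; toℕ)
open import Data.Fin.Properties using () renaming (_≟_ to _≟ᶠ_)
open import Data.List using (List; []; _∷_; [_]; map; concatMap; allFin; filterᵇ; length; cartesianProduct)
open import Data.Vec using (Vec; lookup) renaming ([] to []ᵛ; _∷_ to _∷ᵛ_)
open import Data.Product using (Σ; _×_; _,_)
open import Data.Integer using (+_)
open import Data.Rational using (ℚ; _/_)
open import Relation.Nullary using (¬_)
open import Relation.Nullary.Decidable using (⌊_⌋)
open import Relation.Binary.PropositionalEquality using (_≡_; _≢_)
open import Function.Definitions using (Injective)

toℚ : ℕ → ℚ
toℚ m = + m / 1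

record Graph (n : ℕ) : Set where
  field
    adj   : Fin n → Fin n → Bool
    sym   : ∀ u v → adj u v ≡ adj v u
    loopless : ∀ v → adj v v ≡ false
open Graph public

-- A partition V = A ∪ B is given by a map side : Fin n → Bool (true = A, false = B).
Partition : ℕ → Set
Partition n = Fin n → Bool

cross : ∀ {n} → Partition n → Fin n → Fin n → Bool
cross side u v = not ⌊ side u Data.Bool.≟ side v ⌋

adj₁ : ∀ {n} → Graph n → Partition n → Fin n → Fin n → Bool
adj₁ G side u v = adj G u v ∧ cross side u v

deg₁ : ∀ {n} → Graph n → Partition n → Fin n → ℕ
deg₁ {n} G side v = length (filterᵇ (λ u → adj₁ G side u v) (allFin n))

eAB : ∀ {n} → Graph n → Partition n → ℕ
eAB {n} G side =
  length (filterᵇ (λ { (u , v) → side u ∧ not (side v) ∧ adj G u v })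
                  (cartesianProduct (allFin n) (allFin n)))

AlmostRegular : ∀ {n} → ℚ → Graph n → Partition n → Set
AlmostRegular {n} K G side =
  ∀ (u v : Fin n) → toℚ (deg₁ G side u) Data.Rational.≤ K Data.Rational.* toℚ (deg₁ G side v)

ContainsKss : ℕ → ∀ {n} → Graph n → Set
ContainsKss s {n} G =
  Σ (Fin s → Fin n) λ f → Σ (Fin s → Fin n) λ g →
    Injective _≡_ _≡_ f × Injective _≡_ _≡_ g ×
    (∀ i j → f i ≢ g j) × (∀ i j → adj G (f i) (g j) ≡ true)

KssFree : ℕ → ∀ {n} → Graph n → Set
KssFree s G = ¬ ContainsKss s G

allVecs : ∀ m n → List (Vec (Fin n) m)
allVecs zero n = [ []ᵛ ]
allVecs (suc m) n = concatMap (λ x → map (x ∷ᵛ_) (allVecs m n)) (allFin n)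

all : ∀ {A : Set} → (A → Bool) → List A → Bool
all p [] = true
all p (x ∷ xs) = p x ∧ all p xs

_≡ᶠ_ : ∀ {n} → Fin n → Fin n → Bool
a ≡ᶠ b = ⌊ a ≟ᶠ b ⌋

-- A path of length k is a sequence v₀,…,v_k of k+1 distinct vertices with
-- v_i v_{i+1} ∈ E(G).  It is alternating if every edge v_i v_{i+1} goes
-- between A and B.
IsAltPath : ∀ {n} k → Graph n → Partition n → Vec (Fin n) (suc k) → Bool
IsAltPath {n} k G side p =
  all (λ i → all (λ j → (i ≡ᶠ j) Data.Bool.∨ not (lookup p i ≡ᶠ lookup p j)) (allFin (suc k))) (allFin (suc k))
  ∧ all (λ i → all (λ j →
        if suc (toℕ i) ≡ᵇ toℕ j
        then adj G (lookup p i) (lookup p j) ∧ cross side (lookup p i) (lookup p j)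
        else true) (allFin (suc k))) (allFin (suc k))

IsInduced : ∀ {n} k → Graph n → Vec (Fin n) (suc k) → Bool
IsInduced {n} k G p =
  all (λ i → all (λ j →
        if suc (toℕ i) <ᵇ toℕ j
        then not (adj G (lookup p i) (lookup p j))
        else true) (allFin (suc k))) (allFin (suc k))

-- number of alternating paths of length k (as vertex sequences; each
-- path is counted twice, once per direction, which does not affect ratios)
#altPaths : ∀ {n} k → Graph n → Partition n → ℕ
#altPaths {n} k G side = length (filterᵇ (IsAltPath k G side) (allVecs (suc k) n))

#inducedAltPaths : ∀ {n} k → Graph n → Partition n → ℕ
#inducedAltPaths {n} k G side =
  length (filterᵇ (λ p → IsAltPath k G side p ∧ IsInduced k G p) (allVecs (suc k) n))

module Submission where

-- A non-induced alternating path v₀ … v_k is in particular a walk in G₁ with a chord v_i v_j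
-- (j ≥ i + 2) of G. Deleting the walk's edges one at a time, each at a cost of a factor Δ (the
-- maximum degree of G₁), reduces counting such walks to n Δ^(k−2) times the number of "linked
-- pairs" (x, z) with x ∈ N₁(u), z ∈ N₁(y) and xz ∈ E(G). As G has no K_{s,s}, only O(1) vertices
-- z have more than Δ/M neighbours in N₁(u), so there are at most 2Δ²/M linked pairs and at most
-- (k+1)² · 2nΔ^k/M non-induced alternating paths. Greedy extension gives at least
-- n(δ − k)^k ≥ n(δ/2)^k alternating paths, δ the minimum degree of G₁. Almost-regularity gives
-- Δ ≤ Kδ and the edge count forces δ to be large, so a large constant M makes the non-induced
-- paths an ε-fraction.


open import Data.Bool using (Bool; true; false; _∧_; _∨_; not; T; if_then_else_)
open import Data.Bool.Properties using (∧-identityʳ; ∧-zeroʳ; ∧-assoc)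
open import Data.Empty using (⊥-elim)
open import Data.Fin using (Fin; zero; suc; toℕ; inject₁)
open import Data.Fin.Properties using (toℕ-inject₁) renaming (suc-injective to Fin-suc-injective; _≟_ to _≟ᶠ_)
open import Data.List using (List; []; _∷_; _++_; map; concatMap; allFin; tabulate; filterᵇ; length; cartesianProduct)
open import Data.List.Extrema.Nat using (argmin; f[argmin]≤f[xs])
open import Data.List.Membership.Propositional.Properties using (∈-allFin)
import Data.List.Relation.Unary.All as All
open import Data.Nat
open import Data.Nat.Properties
open import Data.Nat.Tactic.RingSolver using (solve-∀)
open import Data.Product using (Σ; _×_; _,_; proj₁; proj₂)
open import Data.Rational using (ℚ; 0ℚ; 1ℚ; _-_) renaming (_≤_ to _≤ℚ_; _<_ to _<ℚ_; _*_ to _*ℚ_)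
open import Data.Unit using (tt)
open import Data.Vec using (Vec; lookup) renaming ([] to []ᵛ; _∷_ to _∷ᵛ_)
open import Function using (_∘_; id)
open import Function.Definitions using (Injective)
open import Relation.Binary.PropositionalEquality
open import Relation.Nullary using (yes; no)
open import Relation.Nullary.Decidable using (⌊_⌋)
open import Algebra.Properties.Semiring.Sum +-*-semiring
  using (sum; sum-syntax; sum-cong-≗; ∑-comm; ∑-distrib-+; *-distribˡ-sum; *-distribʳ-sum)
open import Algebra.Properties.CommutativeSemigroup *-commutativeSemigroup
  using () renaming (interchange to *-interchange; x∙yz≈y∙xz to *-leftComm)
open import Defs renaming (sym to adj-sym)

⟦_⟧ : Bool → ℕ
⟦ true ⟧ = 1
⟦ false ⟧ = 0

⟦∧⟧ : ∀ a b → ⟦ a ∧ b ⟧ ≡ ⟦ a ⟧ * ⟦ b ⟧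
⟦∧⟧ true b = sym (+-identityʳ ⟦ b ⟧)
⟦∧⟧ false b = refl

⟦∧∧⟧ : ∀ a b c → ⟦ (a ∧ b) ∧ c ⟧ ≡ ⟦ a ⟧ * ⟦ b ∧ c ⟧
⟦∧∧⟧ a b c = trans (cong ⟦_⟧ (∧-assoc a b c)) (⟦∧⟧ a (b ∧ c))

⟦⟧≤1 : ∀ a → ⟦ a ⟧ ≤ 1
⟦⟧≤1 true = ≤-refl
⟦⟧≤1 false = z≤n

⟦⟧*-≤ : ∀ a m → ⟦ a ⟧ * m ≤ m
⟦⟧*-≤ true m = ≤-reflexive (*-identityˡ m)
⟦⟧*-≤ false m = z≤n

⟦⟧-split : ∀ a b → ⟦ a ⟧ ≡ ⟦ a ∧ b ⟧ + ⟦ a ∧ not b ⟧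
⟦⟧-split false b = refl
⟦⟧-split true true = refl
⟦⟧-split true false = refl

∧-true : ∀ {a b} → a ∧ b ≡ true → a ≡ true × b ≡ true
∧-true {true} {true} _ = refl , refl

^-distribʳ-* : ∀ m n o → (m * n) ^ o ≡ m ^ o * n ^ o
^-distribʳ-* m n zero = refl
^-distribʳ-* m n (suc o) = trans (cong (m * n *_) (^-distribʳ-* m n o)) (*-interchange m n (m ^ o) (n ^ o))

^-cancelʳ-≤ : ∀ k a b → a ^ suc k ≤ b ^ suc k → a ≤ b
^-cancelʳ-≤ k a b aᵏ≤bᵏ with a ≤? b
... | yes a≤b = a≤b
... | no a≰b = ⊥-elim (<⇒≱ (^-monoˡ-< (suc k) (≰⇒> a≰b)) aᵏ≤bᵏ)

m≤2[m∸n] : ∀ m n → 2 * n ≤ m → m ≤ 2 * (m ∸ n)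
m≤2[m∸n] m n 2n≤m = begin
  m                ≡⟨ sym (m∸n+n≡m (≤-trans (m≤m+n n (n + 0)) 2n≤m)) ⟩
  m ∸ n + n        ≤⟨ +-monoʳ-≤ (m ∸ n) (m+n≤o⇒m≤o∸n n (≤-trans (≤-reflexive (cong (n +_) (sym (+-identityʳ n)))) 2n≤m)) ⟩
  m ∸ n + (m ∸ n)  ≡⟨ cong (m ∸ n +_) (sym (+-identityʳ (m ∸ n))) ⟩
  2 * (m ∸ n)      ∎
  where open ≤-Reasoning

summands≤ : ∀ a b c {d} → a + b + c + 1 ≤ d → a ≤ d × b ≤ d × c ≤ d × 0 < d
summands≤ a b c {d} a+b+c<d = ≤-trans (m≤m+n a b) a+b≤d , ≤-trans (m≤n+m b a) a+b≤d ,
  ≤-trans (m≤n+m c (a + b)) a+b+c≤d , ≤-trans (m≤n+m 1 (a + b + c)) a+b+c<d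
  where
  a+b+c≤d : a + b + c ≤ d
  a+b+c≤d = ≤-trans (m≤m+n (a + b + c) 1) a+b+c<d
  a+b≤d : a + b ≤ d
  a+b≤d = ≤-trans (m≤m+n (a + b) c) a+b+c≤d

sum-mono-≤ : ∀ {n} {f g : Fin n → ℕ} → (∀ i → f i ≤ g i) → sum f ≤ sum g
sum-mono-≤ {zero} f≤g = z≤n
sum-mono-≤ {suc n} f≤g = +-mono-≤ (f≤g zero) (sum-mono-≤ (f≤g ∘ suc))

sum-const : ∀ n c → ∑[ i < n ] c ≡ n * c
sum-const zero c = refl
sum-const (suc n) c = cong (c +_) (sum-const n c)

∑-zero : ∀ {n} {f : Fin n → ℕ} → (∀ i → f i ≡ 0) → sum f ≡ 0
∑-zero {n} f≡0 = trans (sum-cong-≗ {n} f≡0) (trans (sum-const n 0) (*-zeroʳ n))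

sum-⟦≡⟧≤1 : ∀ {n} (y : Fin n) → ∑[ x < n ] ⟦ x ≡ᶠ y ⟧ ≤ 1
sum-⟦≡⟧≤1 {suc n} zero = s≤s (≤-reflexive (trans (sum-const n 0) (*-zeroʳ n)))
sum-⟦≡⟧≤1 {suc n} (suc y) = ≤-trans (≤-reflexive (sum-cong-≗ {n} ⟦suc≡suc⟧)) (sum-⟦≡⟧≤1 y)
  where
  ⟦suc≡suc⟧ : ∀ x → ⟦ suc x ≡ᶠ suc y ⟧ ≡ ⟦ x ≡ᶠ y ⟧
  ⟦suc≡suc⟧ x with x ≟ᶠ y
  ... | yes _ = refl
  ... | no _ = refl

∑-exchange : ∀ {n} c (a b : Fin n → ℕ) (f : Fin n → Fin n → ℕ) →
  c * ∑[ x < n ] (a x * ∑[ z < n ] (b z * f x z)) ≡ ∑[ z < n ] (b z * (c * ∑[ x < n ] (a x * f x z)))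
∑-exchange {n} c a b f = begin
  c * ∑[ x < n ] (a x * ∑[ z < n ] (b z * f x z))
    ≡⟨ cong (c *_) (sum-cong-≗ {n} λ x → *-distribˡ-sum (a x) λ z → b z * f x z) ⟩
  c * ∑[ x < n ] ∑[ z < n ] (a x * (b z * f x z))
    ≡⟨ cong (c *_) (∑-comm (λ x z → a x * (b z * f x z))) ⟩
  c * ∑[ z < n ] ∑[ x < n ] (a x * (b z * f x z))
    ≡⟨ cong (c *_) (sum-cong-≗ {n} λ z → trans (sum-cong-≗ {n} λ x → *-leftComm (a x) (b z) (f x z))
         (sym (*-distribˡ-sum (b z) λ x → a x * f x z))) ⟩
  c * ∑[ z < n ] (b z * ∑[ x < n ] (a x * f x z))
    ≡⟨ *-distribˡ-sum c (λ z → b z * ∑[ x < n ] (a x * f x z)) ⟩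
  ∑[ z < n ] (c * (b z * ∑[ x < n ] (a x * f x z)))
    ≡⟨ sum-cong-≗ {n} (λ z → *-leftComm c (b z) _) ⟩
  ∑[ z < n ] (b z * (c * ∑[ x < n ] (a x * f x z))) ∎
  where open ≡-Reasoning

∑ᴸ : ∀ {A : Set} → List A → (A → ℕ) → ℕ
∑ᴸ [] f = 0
∑ᴸ (x ∷ xs) f = f x + ∑ᴸ xs f

length-filterᵇ : ∀ {A : Set} (p : A → Bool) xs → length (filterᵇ p xs) ≡ ∑ᴸ xs (⟦_⟧ ∘ p)
length-filterᵇ p [] = refl
length-filterᵇ p (x ∷ xs) with p x
... | true = cong suc (length-filterᵇ p xs)
... | false = length-filterᵇ p xs

∑ᴸ-mono-≤ : ∀ {A : Set} (xs : List A) {f g : A → ℕ} → (∀ x → f x ≤ g x) → ∑ᴸ xs f ≤ ∑ᴸ xs g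
∑ᴸ-mono-≤ [] f≤g = z≤n
∑ᴸ-mono-≤ (x ∷ xs) f≤g = +-mono-≤ (f≤g x) (∑ᴸ-mono-≤ xs f≤g)

∑ᴸ-++ : ∀ {A : Set} (xs ys : List A) f → ∑ᴸ (xs ++ ys) f ≡ ∑ᴸ xs f + ∑ᴸ ys f
∑ᴸ-++ [] ys f = refl
∑ᴸ-++ (x ∷ xs) ys f = trans (cong (f x +_) (∑ᴸ-++ xs ys f)) (sym (+-assoc (f x) _ _))

∑ᴸ-map : ∀ {A B : Set} (g : A → B) xs f → ∑ᴸ (map g xs) f ≡ ∑ᴸ xs (f ∘ g)
∑ᴸ-map g [] f = refl
∑ᴸ-map g (x ∷ xs) f = cong (f (g x) +_) (∑ᴸ-map g xs f)

∑ᴸ-concatMap : ∀ {A B : Set} (g : A → List B) xs f → ∑ᴸ (concatMap g xs) f ≡ ∑ᴸ xs (λ x → ∑ᴸ (g x) f)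
∑ᴸ-concatMap g [] f = refl
∑ᴸ-concatMap g (x ∷ xs) f = trans (∑ᴸ-++ (g x) _ f) (cong (∑ᴸ (g x) f +_) (∑ᴸ-concatMap g xs f))

∑ᴸ-tabulate : ∀ {A : Set} n (g : Fin n → A) f → ∑ᴸ (tabulate g) f ≡ ∑[ i < n ] f (g i)
∑ᴸ-tabulate zero g f = refl
∑ᴸ-tabulate (suc n) g f = cong (f (g zero) +_) (∑ᴸ-tabulate n (g ∘ suc) f)

∑ᴸ-allFin : ∀ n f → ∑ᴸ (allFin n) f ≡ ∑[ i < n ] f i
∑ᴸ-allFin n = ∑ᴸ-tabulate n id

∑ᴸ-cartesianProduct : ∀ {A B : Set} (xs : List A) (ys : List B) f →
  ∑ᴸ (cartesianProduct xs ys) f ≡ ∑ᴸ xs (λ u → ∑ᴸ ys (λ v → f (u , v)))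
∑ᴸ-cartesianProduct [] ys f = refl
∑ᴸ-cartesianProduct (x ∷ xs) ys f =
  trans (∑ᴸ-++ (map (x ,_) ys) _ f) (cong₂ _+_ (∑ᴸ-map (x ,_) ys f) (∑ᴸ-cartesianProduct xs ys f))

⟦not-all⟧≤ : ∀ {A : Set} b (f : A → Bool) xs → ⟦ b ∧ not (all f xs) ⟧ ≤ ∑ᴸ xs (λ x → ⟦ b ∧ not (f x) ⟧)
⟦not-all⟧≤ false f xs = z≤n
⟦not-all⟧≤ true f [] = z≤n
⟦not-all⟧≤ true f (x ∷ xs) with f x
... | true = ⟦not-all⟧≤ true f xs
... | false = s≤s z≤n

all-tabulate⁻ : ∀ {A : Set} {n} (f : A → Bool) (g : Fin n → A) → all f (tabulate g) ≡ true → ∀ i → f (g i) ≡ true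
all-tabulate⁻ f g all-f zero = proj₁ (∧-true all-f)
all-tabulate⁻ f g all-f (suc i) = all-tabulate⁻ f (g ∘ suc) (proj₂ (∧-true {f (g zero)} all-f)) i

all-tabulate⁺ : ∀ {A : Set} {n} (f : A → Bool) (g : Fin n → A) → (∀ i → f (g i) ≡ true) → all f (tabulate g) ≡ true
all-tabulate⁺ {n = zero} f g f-true = refl
all-tabulate⁺ {n = suc n} f g f-true = cong₂ _∧_ (f-true zero) (all-tabulate⁺ f (g ∘ suc) (f-true ∘ suc))

∑ⱽ : ∀ {n} m → (Vec (Fin n) m → ℕ) → ℕ
∑ⱽ zero f = f []ᵛ
∑ⱽ {n} (suc m) f = ∑[ x < n ] ∑ⱽ m (λ q → f (x ∷ᵛ q))

∑ᴸ-allVecs : ∀ m n f → ∑ᴸ (allVecs m n) f ≡ ∑ⱽ m f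
∑ᴸ-allVecs zero n f = +-identityʳ _
∑ᴸ-allVecs (suc m) n f = trans (∑ᴸ-concatMap _ (allFin n) f) (trans (∑ᴸ-allFin n _)
  (sum-cong-≗ λ x → trans (∑ᴸ-map (x ∷ᵛ_) (allVecs m n) f) (∑ᴸ-allVecs m n _)))

count-allVecs : ∀ m n (p : Vec (Fin n) m → Bool) → length (filterᵇ p (allVecs m n)) ≡ ∑ⱽ m (⟦_⟧ ∘ p)
count-allVecs m n p = trans (length-filterᵇ p (allVecs m n)) (∑ᴸ-allVecs m n _)

∑ⱽ-cong : ∀ {n} m {f g : Vec (Fin n) m → ℕ} → (∀ q → f q ≡ g q) → ∑ⱽ m f ≡ ∑ⱽ m g
∑ⱽ-cong zero f≡g = f≡g []ᵛ
∑ⱽ-cong (suc m) f≡g = sum-cong-≗ λ x → ∑ⱽ-cong m (f≡g ∘ (x ∷ᵛ_))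

∑ⱽ-mono-≤ : ∀ {n} m {f g : Vec (Fin n) m → ℕ} → (∀ q → f q ≤ g q) → ∑ⱽ m f ≤ ∑ⱽ m g
∑ⱽ-mono-≤ zero f≤g = f≤g []ᵛ
∑ⱽ-mono-≤ (suc m) f≤g = sum-mono-≤ λ x → ∑ⱽ-mono-≤ m (f≤g ∘ (x ∷ᵛ_))

*-distribˡ-∑ⱽ : ∀ {n} m c (f : Vec (Fin n) m → ℕ) → c * ∑ⱽ m f ≡ ∑ⱽ m (λ q → c * f q)
*-distribˡ-∑ⱽ zero c f = refl
*-distribˡ-∑ⱽ (suc m) c f = trans (*-distribˡ-sum c λ x → ∑ⱽ m (f ∘ (x ∷ᵛ_))) (sum-cong-≗ λ x → *-distribˡ-∑ⱽ m c (f ∘ (x ∷ᵛ_)))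

∑ⱽ-distrib-+ : ∀ {n} m (f g : Vec (Fin n) m → ℕ) → ∑ⱽ m (λ q → f q + g q) ≡ ∑ⱽ m f + ∑ⱽ m g
∑ⱽ-distrib-+ zero f g = refl
∑ⱽ-distrib-+ {n} (suc m) f g = trans (sum-cong-≗ {n} λ x → ∑ⱽ-distrib-+ m (f ∘ (x ∷ᵛ_)) (g ∘ (x ∷ᵛ_)))
  (∑-distrib-+ {n} (λ x → ∑ⱽ m (f ∘ (x ∷ᵛ_))) (λ x → ∑ⱽ m (g ∘ (x ∷ᵛ_))))

∑ⱽ-comm : ∀ {n k} m (f : Vec (Fin n) m → Fin k → ℕ) → ∑ⱽ m (λ q → ∑[ x < k ] f q x) ≡ ∑[ x < k ] ∑ⱽ m (λ q → f q x)
∑ⱽ-comm zero f = refl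
∑ⱽ-comm {n} {k} (suc m) f = trans (sum-cong-≗ {n} λ y → ∑ⱽ-comm m λ q x → f (y ∷ᵛ q) x) (∑-comm {n} {k} λ y x → ∑ⱽ m (λ q → f (y ∷ᵛ q) x))

∑ⱽ-zero : ∀ {n} m → ∑ⱽ {n} m (λ _ → 0) ≡ 0
∑ⱽ-zero m = sym (*-distribˡ-∑ⱽ m 0 λ _ → 0)

∑ⱽ-extend : ∀ {n m} (P : Vec (Fin n) m → Bool) (Q : Vec (Fin n) (suc m) → Bool) d →
  (∀ q → P q ≡ true → d ≤ ∑[ x < n ] ⟦ Q (x ∷ᵛ q) ⟧) →
  d * ∑ⱽ m (⟦_⟧ ∘ P) ≤ ∑ⱽ (suc m) (⟦_⟧ ∘ Q)
∑ⱽ-extend {n} {m} P Q d extends = begin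
  d * ∑ⱽ m (⟦_⟧ ∘ P)                     ≡⟨ *-distribˡ-∑ⱽ m d _ ⟩
  ∑ⱽ m (λ q → d * ⟦ P q ⟧)               ≤⟨ ∑ⱽ-mono-≤ m pointwise ⟩
  ∑ⱽ m (λ q → ∑[ x < n ] ⟦ Q (x ∷ᵛ q) ⟧) ≡⟨ ∑ⱽ-comm m (λ q x → ⟦ Q (x ∷ᵛ q) ⟧) ⟩
  ∑ⱽ (suc m) (⟦_⟧ ∘ Q)                   ∎
  where
  open ≤-Reasoning
  pointwise : ∀ q → d * ⟦ P q ⟧ ≤ ∑[ x < n ] ⟦ Q (x ∷ᵛ q) ⟧
  pointwise q with P q in Pq
  ... | true = ≤-trans (≤-reflexive (*-identityʳ d)) (extends q Pq)
  ... | false = ≤-trans (≤-reflexive (*-zeroʳ d)) z≤n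

allᵛ : ∀ {n m} → (Fin n → Bool) → Vec (Fin n) m → Bool
allᵛ P []ᵛ = true
allᵛ P (x ∷ᵛ q) = P x ∧ allᵛ P q

_∉ᵇ_ : ∀ {n m} → Fin n → Vec (Fin n) m → Bool
x ∉ᵇ q = allᵛ (λ y → not (x ≡ᶠ y)) q

Fresh : ∀ {n m} → Vec (Fin n) m → Bool
Fresh []ᵛ = true
Fresh (x ∷ᵛ q) = x ∉ᵇ q ∧ Fresh q

allᵛ-lookup : ∀ {n m} (P : Fin n → Bool) (q : Vec (Fin n) m) → allᵛ P q ≡ true → ∀ j → P (lookup q j) ≡ true
allᵛ-lookup P (x ∷ᵛ q) Pxq zero = proj₁ (∧-true Pxq)
allᵛ-lookup P (x ∷ᵛ q) Pxq (suc j) = allᵛ-lookup P q (proj₂ (∧-true {P x} Pxq)) j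

∉ᵇ-lookup : ∀ {n m} {x : Fin n} (q : Vec (Fin n) m) → x ∉ᵇ q ≡ true → ∀ j → x ≢ lookup q j
∉ᵇ-lookup {x = x} q x∉q j x≡qj with x ≟ᶠ lookup q j | allᵛ-lookup _ q x∉q j
... | no x≢qj | _ = x≢qj x≡qj

Fresh-injective : ∀ {n m} (q : Vec (Fin n) m) → Fresh q ≡ true → Injective _≡_ _≡_ (lookup q)
Fresh-injective (x ∷ᵛ q) fresh {zero} {zero} _ = refl
Fresh-injective (x ∷ᵛ q) fresh {zero} {suc j} x≡qj = ⊥-elim (∉ᵇ-lookup q (proj₁ (∧-true fresh)) j x≡qj)
Fresh-injective (x ∷ᵛ q) fresh {suc i} {zero} qi≡x = ⊥-elim (∉ᵇ-lookup q (proj₁ (∧-true fresh)) i (sym qi≡x))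
Fresh-injective (x ∷ᵛ q) fresh {suc i} {suc j} qi≡qj =
  cong suc (Fresh-injective q (proj₂ (∧-true {x ∉ᵇ q} fresh)) qi≡qj)

count-∉ᵇ : ∀ {n m} (B : Fin n → Bool) (q : Vec (Fin n) m) →
  ∑[ x < n ] ⟦ B x ⟧ ∸ m ≤ ∑[ x < n ] ⟦ B x ∧ x ∉ᵇ q ⟧
count-∉ᵇ {n} B []ᵛ = ≤-reflexive (sum-cong-≗ {n} λ x → cong ⟦_⟧ (sym (∧-identityʳ (B x))))
count-∉ᵇ {n} {suc m} B (y ∷ᵛ q) = begin
  ∑[ x < n ] ⟦ B x ⟧ ∸ suc m
    ≡⟨ cong (_∸ suc m) (trans (sum-cong-≗ {n} λ x → ⟦⟧-split (B x) (x ≡ᶠ y)) (∑-distrib-+ {n} _ _)) ⟩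
  (∑[ x < n ] ⟦ B x ∧ x ≡ᶠ y ⟧ + ∑[ x < n ] ⟦ B′ x ⟧) ∸ suc m
    ≤⟨ ∸-monoˡ-≤ (suc m) (+-monoˡ-≤ (∑[ x < n ] ⟦ B′ x ⟧) (≤-trans (sum-mono-≤ (λ x → ⟦∧⟧≤ʳ (B x) _)) (sum-⟦≡⟧≤1 y))) ⟩
  (1 + ∑[ x < n ] ⟦ B′ x ⟧) ∸ suc m
    ≡⟨⟩
  ∑[ x < n ] ⟦ B′ x ⟧ ∸ m
    ≤⟨ count-∉ᵇ B′ q ⟩
  ∑[ x < n ] ⟦ B′ x ∧ x ∉ᵇ q ⟧
    ≡⟨ sum-cong-≗ {n} (λ x → cong ⟦_⟧ (∧-assoc (B x) _ _)) ⟩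
  ∑[ x < n ] ⟦ B x ∧ x ∉ᵇ (y ∷ᵛ q) ⟧ ∎
  where
  open ≤-Reasoning
  B′ : Fin _ → Bool
  B′ x = B x ∧ not (x ≡ᶠ y)
  ⟦∧⟧≤ʳ : ∀ a b → ⟦ a ∧ b ⟧ ≤ ⟦ b ⟧
  ⟦∧⟧≤ʳ true b = ≤-refl
  ⟦∧⟧≤ʳ false b = z≤n

allᵛ-∧ : ∀ {n m} (P Q : Fin n → Bool) (q : Vec (Fin n) m) → allᵛ (λ x → P x ∧ Q x) q ≡ allᵛ P q ∧ allᵛ Q q
allᵛ-∧ P Q []ᵛ = refl
allᵛ-∧ P Q (x ∷ᵛ q) rewrite allᵛ-∧ P Q q = ∧-interchange (P x) (Q x) (allᵛ P q) (allᵛ Q q)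
  where
  ∧-interchange : ∀ a b c d → (a ∧ b) ∧ (c ∧ d) ≡ (a ∧ c) ∧ (b ∧ d)
  ∧-interchange false b c d = refl
  ∧-interchange true true c d = refl
  ∧-interchange true false c d = sym (∧-zeroʳ c)

∑ⱽ-allᵛ : ∀ {n} (X : Fin n → Bool) m → ∑ⱽ m (⟦_⟧ ∘ allᵛ X) ≡ (∑[ x < n ] ⟦ X x ⟧) ^ m
∑ⱽ-allᵛ X zero = refl
∑ⱽ-allᵛ {n} X (suc m) = begin
  ∑[ x < n ] ∑ⱽ m (λ q → ⟦ X x ∧ allᵛ X q ⟧)     ≡⟨ sum-cong-≗ {n} (λ x → ∑ⱽ-cong m λ q → ⟦∧⟧ (X x) (allᵛ X q)) ⟩
  ∑[ x < n ] ∑ⱽ m (λ q → ⟦ X x ⟧ * ⟦ allᵛ X q ⟧) ≡⟨ sum-cong-≗ {n} (λ x → sym (*-distribˡ-∑ⱽ m ⟦ X x ⟧ _)) ⟩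
  ∑[ x < n ] (⟦ X x ⟧ * ∑ⱽ m (⟦_⟧ ∘ allᵛ X))     ≡⟨ sym (*-distribʳ-sum _ λ x → ⟦ X x ⟧) ⟩
  ∑[ x < n ] ⟦ X x ⟧ * ∑ⱽ m (⟦_⟧ ∘ allᵛ X)       ≡⟨ cong (∑[ x < n ] ⟦ X x ⟧ *_) (∑ⱽ-allᵛ X m) ⟩
  (∑[ x < n ] ⟦ X x ⟧) ^ suc m                   ∎
  where open ≡-Reasoning

freshTuples≥ : ∀ {n} (B : Fin n → Bool) m →
  (∑[ x < n ] ⟦ B x ⟧ ∸ m) ^ m ≤ ∑ⱽ m (λ q → ⟦ allᵛ B q ∧ Fresh q ⟧)
freshTuples≥ B zero = ≤-refl
freshTuples≥ {n} B (suc m) = begin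
  (b ∸ suc m) * (b ∸ suc m) ^ m                     ≤⟨ *-mono-≤ b∸sm≤b∸m (^-monoˡ-≤ m b∸sm≤b∸m) ⟩
  (b ∸ m) * (b ∸ m) ^ m                             ≤⟨ *-monoʳ-≤ (b ∸ m) (freshTuples≥ B m) ⟩
  (b ∸ m) * ∑ⱽ m (λ q → ⟦ allᵛ B q ∧ Fresh q ⟧)     ≤⟨ ∑ⱽ-extend {m = m} good good (b ∸ m) extends ⟩
  ∑ⱽ (suc m) (λ q → ⟦ allᵛ B q ∧ Fresh q ⟧)         ∎
  where
  open ≤-Reasoning
  b : ℕ
  b = ∑[ x < n ] ⟦ B x ⟧
  good : ∀ {k} → Vec (Fin n) k → Bool
  good q = allᵛ B q ∧ Fresh q
  b∸sm≤b∸m : b ∸ suc m ≤ b ∸ m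
  b∸sm≤b∸m = ∸-monoʳ-≤ b (n≤1+n m)
  extends : ∀ q → allᵛ B q ∧ Fresh q ≡ true → b ∸ m ≤ ∑[ x < n ] ⟦ (B x ∧ allᵛ B q) ∧ (x ∉ᵇ q ∧ Fresh q) ⟧
  extends q good with allᵛ B q | Fresh q | ∧-true {allᵛ B q} good
  ... | true | true | _ = ≤-trans (count-∉ᵇ B q)
    (≤-reflexive (sum-cong-≗ {n} λ x → cong₂ (λ a c → ⟦ a ∧ c ⟧) (sym (∧-identityʳ (B x))) (sym (∧-identityʳ (x ∉ᵇ q)))))

fin-injection : ∀ {n} (Q : Fin n → Bool) m → m ≤ ∑[ z < n ] ⟦ Q z ⟧ →
  Σ (Fin m → Fin n) λ g → Injective _≡_ _≡_ g × (∀ i → Q (g i) ≡ true)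
fin-injection Q zero _ = (λ ()) , (λ { {()} }) , λ ()
fin-injection {suc n} Q (suc m) m<∑Q with Q zero in Q0
... | true with fin-injection (Q ∘ suc) m (s≤s⁻¹ m<∑Q)
...   | g , g-inj , Qg = g′ , g′-inj , Qg′
  where
  g′ : Fin (suc m) → Fin (suc n)
  g′ zero = zero
  g′ (suc i) = suc (g i)
  g′-inj : Injective _≡_ _≡_ g′
  g′-inj {zero} {zero} _ = refl
  g′-inj {suc i} {suc j} gi≡gj = cong suc (g-inj (Fin-suc-injective gi≡gj))
  Qg′ : ∀ i → Q (g′ i) ≡ true
  Qg′ zero = Q0
  Qg′ (suc i) = Qg i
fin-injection {suc n} Q (suc m) m<∑Q | false with fin-injection (Q ∘ suc) (suc m) m<∑Q
... | g , g-inj , Qg = suc ∘ g , g-inj ∘ Fin-suc-injective , Qg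

-- K_{s,s}-free graphs

module _ {n} (G : Graph n) where

  commonNeighbours≤ : ∀ {s₁} → KssFree (suc s₁) G → (T : Vec (Fin n) (suc s₁)) → Fresh T ≡ true →
    ∑[ z < n ] ⟦ allᵛ (λ x → adj G x z) T ⟧ ≤ s₁
  commonNeighbours≤ {s₁} Kss-free T fresh with suc s₁ ≤? ∑[ z < n ] ⟦ allᵛ (λ x → adj G x z) T ⟧
  ... | no ≰∑ = s≤s⁻¹ (≰⇒> ≰∑)
  ... | yes ≤∑ with fin-injection _ (suc s₁) ≤∑
  ...   | g , g-inj , g-common = ⊥-elim (Kss-free (lookup T , g , Fresh-injective T fresh , g-inj , disjoint , complete))
    where
    complete : ∀ i j → adj G (lookup T i) (g j) ≡ true
    complete i j = allᵛ-lookup (λ x → adj G x (g j)) T (g-common j) i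
    disjoint : ∀ i j → lookup T i ≢ g j
    disjoint i j Ti≡gj with trans (sym (loopless G (g j))) (subst (λ w → adj G w (g j) ≡ true) Ti≡gj (complete i j))
    ... | ()

  degIn : (Fin n → Bool) → Fin n → ℕ
  degIn X z = ∑[ x < n ] ⟦ X x ∧ adj G x z ⟧

  commonTuples≤ : ∀ {s₁} → KssFree (suc s₁) G → ∀ (X : Fin n → Bool) →
    ∑[ z < n ] ∑ⱽ (suc s₁) (λ T → ⟦ allᵛ (λ x → X x ∧ adj G x z) T ∧ Fresh T ⟧) ≤ (∑[ x < n ] ⟦ X x ⟧) ^ suc s₁ * s₁
  commonTuples≤ {s₁} Kss-free X = begin
    ∑[ z < n ] ∑ⱽ s (λ T → ⟦ allᵛ (λ x → X x ∧ adj G x z) T ∧ Fresh T ⟧)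
      ≡⟨ sym (∑ⱽ-comm s λ T z → ⟦ allᵛ (λ x → X x ∧ adj G x z) T ∧ Fresh T ⟧) ⟩
    ∑ⱽ s (λ T → ∑[ z < n ] ⟦ allᵛ (λ x → X x ∧ adj G x z) T ∧ Fresh T ⟧)
      ≤⟨ ∑ⱽ-mono-≤ s common ⟩
    ∑ⱽ s (λ T → s₁ * ⟦ allᵛ X T ⟧)
      ≡⟨ sym (*-distribˡ-∑ⱽ s s₁ (⟦_⟧ ∘ allᵛ X)) ⟩
    s₁ * ∑ⱽ s (⟦_⟧ ∘ allᵛ X)
      ≡⟨ trans (*-comm s₁ (∑ⱽ s (⟦_⟧ ∘ allᵛ X))) (cong (_* s₁) (∑ⱽ-allᵛ X s)) ⟩
    (∑[ x < n ] ⟦ X x ⟧) ^ s * s₁ ∎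
    where
    open ≤-Reasoning
    s : ℕ
    s = suc s₁
    common : ∀ T → ∑[ z < n ] ⟦ allᵛ (λ x → X x ∧ adj G x z) T ∧ Fresh T ⟧ ≤ s₁ * ⟦ allᵛ X T ⟧
    common T with allᵛ X T in X-T | Fresh T in fresh
    ... | true | true = begin
      ∑[ z < n ] ⟦ allᵛ (λ x → X x ∧ adj G x z) T ∧ true ⟧
        ≡⟨ sum-cong-≗ {n} (λ z → cong (λ b → ⟦ b ∧ true ⟧) (trans (allᵛ-∧ X (λ x → adj G x z) T) (cong (_∧ _) X-T))) ⟩
      ∑[ z < n ] ⟦ allᵛ (λ x → adj G x z) T ∧ true ⟧
        ≡⟨ sum-cong-≗ {n} (λ z → cong ⟦_⟧ (∧-identityʳ _)) ⟩
      ∑[ z < n ] ⟦ allᵛ (λ x → adj G x z) T ⟧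
        ≤⟨ commonNeighbours≤ Kss-free T fresh ⟩
      s₁
        ≡⟨ sym (*-identityʳ s₁) ⟩
      s₁ * 1 ∎
    ... | true | false = ≤-trans (≤-reflexive (∑-zero {n} λ z → cong ⟦_⟧ (∧-zeroʳ (allᵛ (λ x → X x ∧ adj G x z) T)))) z≤n
    ... | false | f = ≤-trans (≤-reflexive (∑-zero {n} λ z →
      cong (λ b → ⟦ b ∧ f ⟧) (trans (allᵛ-∧ X (λ x → adj G x z) T) (cong (_∧ _) X-T)))) z≤n

  -- A vertex z with many neighbours in X has many s-tuples of them, but each s-tuple of X
  -- has fewer than s common neighbours.
  heavyVertices≤ : ∀ {s₁} → KssFree (suc s₁) G → ∀ (X : Fin n → Bool) M Δ .{{_ : NonZero Δ}} →
    ∑[ x < n ] ⟦ X x ⟧ ≤ Δ → 2 * M * suc s₁ ≤ Δ →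
    ∑[ z < n ] ⟦ Δ <ᵇ M * degIn X z ⟧ ≤ (2 * M) ^ suc s₁ * s₁
  heavyVertices≤ {s₁} Kss-free X M Δ ∣X∣≤Δ 2Ms≤Δ = *-cancelʳ-≤ _ _ (Δ ^ s) {{m^n≢0 Δ s}} (begin
    (∑[ z < n ] ⟦ heavy z ⟧) * Δ ^ s        ≡⟨ *-distribʳ-sum (Δ ^ s) (⟦_⟧ ∘ heavy) ⟩
    ∑[ z < n ] (⟦ heavy z ⟧ * Δ ^ s)        ≤⟨ sum-mono-≤ heavy-tuples ⟩
    ∑[ z < n ] ((2 * M) ^ s * tuples z)     ≡⟨ sym (*-distribˡ-sum ((2 * M) ^ s) tuples) ⟩
    (2 * M) ^ s * ∑[ z < n ] tuples z       ≤⟨ *-monoʳ-≤ ((2 * M) ^ s) (≤-trans (commonTuples≤ Kss-free X) (*-monoˡ-≤ s₁ (^-monoˡ-≤ s ∣X∣≤Δ))) ⟩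
    (2 * M) ^ s * (Δ ^ s * s₁)              ≡⟨ cong ((2 * M) ^ s *_) (*-comm (Δ ^ s) s₁) ⟩
    (2 * M) ^ s * (s₁ * Δ ^ s)              ≡⟨ sym (*-assoc ((2 * M) ^ s) s₁ (Δ ^ s)) ⟩
    (2 * M) ^ s * s₁ * Δ ^ s                ∎)
    where
    open ≤-Reasoning
    s : ℕ
    s = suc s₁
    heavy : Fin n → Bool
    heavy z = Δ <ᵇ M * degIn X z
    tuples : Fin n → ℕ
    tuples z = ∑ⱽ s (λ T → ⟦ allᵛ (λ x → X x ∧ adj G x z) T ∧ Fresh T ⟧)

    heavy-tuples : ∀ z → ⟦ heavy z ⟧ * Δ ^ s ≤ (2 * M) ^ s * tuples z
    heavy-tuples z with heavy z in heavy-z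
    ... | false = z≤n
    ... | true = begin
      1 * Δ ^ s                      ≡⟨ *-identityˡ (Δ ^ s) ⟩
      Δ ^ s                          ≤⟨ ^-monoˡ-≤ s Δ≤2M[a∸s] ⟩
      (2 * M * (a ∸ s)) ^ s          ≡⟨ ^-distribʳ-* (2 * M) (a ∸ s) s ⟩
      (2 * M) ^ s * (a ∸ s) ^ s      ≤⟨ *-monoʳ-≤ ((2 * M) ^ s) (freshTuples≥ (λ x → X x ∧ adj G x z) s) ⟩
      (2 * M) ^ s * tuples z         ∎
      where
      a = degIn X z
      Δ<Ma : Δ < M * a
      Δ<Ma = <ᵇ⇒< Δ (M * a) (subst T (sym heavy-z) tt)
      Δ≤2M[a∸s] : Δ ≤ 2 * M * (a ∸ s)
      Δ≤2M[a∸s] = ≤-trans (m+n≤o⇒m≤o∸n Δ (begin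
        Δ + 2 * M * s    ≤⟨ +-mono-≤ (<⇒≤ Δ<Ma) (≤-trans 2Ms≤Δ (<⇒≤ Δ<Ma)) ⟩
        M * a + M * a    ≡⟨ cong (M * a +_) (sym (+-identityʳ (M * a))) ⟩
        2 * (M * a)      ≡⟨ sym (*-assoc 2 M a) ⟩
        2 * M * a        ∎)) (≤-reflexive (sym (*-distribˡ-∸ (2 * M) a s)))

-- Alternating walks and chords

#nonInducedAltPaths : ∀ {n} k → Graph n → Partition n → ℕ
#nonInducedAltPaths k G side = ∑ⱽ (suc k) (λ p → ⟦ IsAltPath k G side p ∧ not (IsInduced k G p) ⟧)

module _ {n} (G : Graph n) (side : Partition n) where

  private
    _~₁_ : Fin n → Fin n → Bool
    _~₁_ = adj₁ G side
    deg : Fin n → ℕ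
    deg = deg₁ G side

  deg₁-as-sum : ∀ v → deg v ≡ ∑[ u < n ] ⟦ u ~₁ v ⟧
  deg₁-as-sum v = trans (length-filterᵇ _ (allFin n)) (∑ᴸ-allFin n _)

  adj₁-sym : ∀ u v → u ~₁ v ≡ v ~₁ u
  adj₁-sym u v = cong₂ _∧_ (adj-sym G u v) (cross-sym (side u) (side v))
    where
    cross-sym : ∀ a b → not ⌊ a Data.Bool.≟ b ⌋ ≡ not ⌊ b Data.Bool.≟ a ⌋
    cross-sym false false = refl
    cross-sym false true = refl
    cross-sym true false = refl
    cross-sym true true = refl

  deg₁-as-sumʳ : ∀ v → deg v ≡ ∑[ u < n ] ⟦ v ~₁ u ⟧
  deg₁-as-sumʳ v = trans (deg₁-as-sum v) (sum-cong-≗ {n} λ u → cong ⟦_⟧ (adj₁-sym u v))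

  AltWalk : ∀ {m} → Vec (Fin n) (suc m) → Bool
  AltWalk {zero} (x ∷ᵛ []ᵛ) = true
  AltWalk {suc m} (x ∷ᵛ y ∷ᵛ r) = x ~₁ y ∧ AltWalk (y ∷ᵛ r)

  AltWalk-intro : ∀ {m} (p : Vec (Fin n) (suc m)) →
    (∀ t → lookup p (inject₁ t) ~₁ lookup p (suc t) ≡ true) → AltWalk p ≡ true
  AltWalk-intro {zero} (x ∷ᵛ []ᵛ) _ = refl
  AltWalk-intro {suc m} (x ∷ᵛ y ∷ᵛ r) steps = cong₂ _∧_ (steps zero) (AltWalk-intro (y ∷ᵛ r) (steps ∘ suc))

  AltWalk-consecutive : ∀ {m} (p : Vec (Fin n) (suc m)) → AltWalk p ≡ true → ∀ i j →
    (if suc (toℕ i) ≡ᵇ toℕ j then lookup p i ~₁ lookup p j else true) ≡ true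
  AltWalk-consecutive {zero} (x ∷ᵛ []ᵛ) _ zero zero = refl
  AltWalk-consecutive {suc m} (x ∷ᵛ y ∷ᵛ r) _ zero zero = refl
  AltWalk-consecutive {suc m} (x ∷ᵛ y ∷ᵛ r) walk zero (suc zero) = proj₁ (∧-true walk)
  AltWalk-consecutive {suc m} (x ∷ᵛ y ∷ᵛ r) _ zero (suc (suc j)) = refl
  AltWalk-consecutive {suc m} (x ∷ᵛ y ∷ᵛ r) _ (suc i) zero = refl
  AltWalk-consecutive {suc m} (x ∷ᵛ y ∷ᵛ r) walk (suc i) (suc j) =
    AltWalk-consecutive (y ∷ᵛ r) (proj₂ (∧-true {x ~₁ y} walk)) i j

  IsAltPath⇒AltWalk : ∀ k (p : Vec (Fin n) (suc k)) → IsAltPath k G side p ≡ true → AltWalk p ≡ true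
  IsAltPath⇒AltWalk k p alt = AltWalk-intro p λ t →
    if-true (≡⇒≡ᵇ _ _ (toℕ-inject₁ t))
      (all-tabulate⁻ (step (inject₁ t)) id (all-tabulate⁻ (λ i → all (step i) (allFin (suc k))) id
        (proj₂ (∧-true {distinct} alt)) (inject₁ t)) (suc t))
    where
    distinct : Bool
    distinct = all (λ i → all (λ j → (i ≡ᶠ j) ∨ not (lookup p i ≡ᶠ lookup p j)) (allFin (suc k))) (allFin (suc k))
    step : Fin (suc k) → Fin (suc k) → Bool
    step i j = if suc (toℕ i) ≡ᵇ toℕ j then lookup p i ~₁ lookup p j else true
    if-true : ∀ {c a} → T c → (if c then a else true) ≡ true → a ≡ true
    if-true {true} _ a = a

  AltWalk∧Fresh⇒IsAltPath : ∀ k (p : Vec (Fin n) (suc k)) → AltWalk p ≡ true → Fresh p ≡ true →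
    IsAltPath k G side p ≡ true
  AltWalk∧Fresh⇒IsAltPath k p walk fresh = cong₂ _∧_
    (all-tabulate⁺ _ id λ i → all-tabulate⁺ _ id λ j → distinct i j)
    (all-tabulate⁺ _ id λ i → all-tabulate⁺ _ id λ j → AltWalk-consecutive p walk i j)
    where
    distinct : ∀ i j → (i ≡ᶠ j) ∨ not (lookup p i ≡ᶠ lookup p j) ≡ true
    distinct i j with i ≟ᶠ j
    ... | yes _ = refl
    ... | no i≢j with lookup p i ≟ᶠ lookup p j
    ...   | yes pi≡pj = ⊥-elim (i≢j (Fresh-injective p fresh pi≡pj))
    ...   | no _ = refl

  Chord : ∀ {m} → Fin (suc m) → Fin (suc m) → Vec (Fin n) (suc m) → Bool
  Chord i j p = (suc (toℕ i) <ᵇ toℕ j) ∧ adj G (lookup p i) (lookup p j)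

  nonInduced≤chords : ∀ k (p : Vec (Fin n) (suc k)) →
    ⟦ IsAltPath k G side p ∧ not (IsInduced k G p) ⟧ ≤ ∑[ i < suc k ] ∑[ j < suc k ] ⟦ AltWalk p ∧ Chord i j p ⟧
  nonInduced≤chords k p = begin
    ⟦ alt ∧ not (IsInduced k G p) ⟧
      ≤⟨ ⟦not-all⟧≤ alt _ (allFin (suc k)) ⟩
    ∑ᴸ (allFin (suc k)) (λ i → ⟦ alt ∧ not (all (noChord i) (allFin (suc k))) ⟧)
      ≤⟨ ∑ᴸ-mono-≤ (allFin (suc k)) (λ i → ⟦not-all⟧≤ alt (noChord i) (allFin (suc k))) ⟩
    ∑ᴸ (allFin (suc k)) (λ i → ∑ᴸ (allFin (suc k)) (λ j → ⟦ alt ∧ not (noChord i j) ⟧))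
      ≤⟨ ∑ᴸ-mono-≤ (allFin (suc k)) (λ i → ∑ᴸ-mono-≤ (allFin (suc k)) (λ j → chord i j alt (IsAltPath⇒AltWalk k p))) ⟩
    ∑ᴸ (allFin (suc k)) (λ i → ∑ᴸ (allFin (suc k)) (λ j → ⟦ AltWalk p ∧ Chord i j p ⟧))
      ≡⟨ trans (∑ᴸ-allFin (suc k) _) (sum-cong-≗ {suc k} λ i → ∑ᴸ-allFin (suc k) λ j → ⟦ AltWalk p ∧ Chord i j p ⟧) ⟩
    ∑[ i < suc k ] ∑[ j < suc k ] ⟦ AltWalk p ∧ Chord i j p ⟧ ∎
    where
    open ≤-Reasoning
    alt : Bool
    alt = IsAltPath k G side p
    noChord : Fin (suc k) → Fin (suc k) → Bool
    noChord i j = if suc (toℕ i) <ᵇ toℕ j then not (adj G (lookup p i) (lookup p j)) else true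
    chord : ∀ i j b → (b ≡ true → AltWalk p ≡ true) → ⟦ b ∧ not (noChord i j) ⟧ ≤ ⟦ AltWalk p ∧ Chord i j p ⟧
    chord i j false _ = z≤n
    chord i j true walk rewrite walk refl with suc (toℕ i) <ᵇ toℕ j | adj G (lookup p i) (lookup p j)
    ... | true | true = ≤-refl
    ... | true | false = z≤n
    ... | false | _ = z≤n

  #altPaths-split : ∀ k → #altPaths k G side ≡ #inducedAltPaths k G side + #nonInducedAltPaths k G side
  #altPaths-split k = begin
    #altPaths k G side
      ≡⟨ count-allVecs (suc k) n (IsAltPath k G side) ⟩
    ∑ⱽ (suc k) (λ p → ⟦ alt p ⟧)
      ≡⟨ ∑ⱽ-cong (suc k) (λ p → ⟦⟧-split (alt p) (IsInduced k G p)) ⟩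
    ∑ⱽ (suc k) (λ p → ⟦ alt p ∧ IsInduced k G p ⟧ + ⟦ alt p ∧ not (IsInduced k G p) ⟧)
      ≡⟨ ∑ⱽ-distrib-+ (suc k) (λ p → ⟦ alt p ∧ IsInduced k G p ⟧) (λ p → ⟦ alt p ∧ not (IsInduced k G p) ⟧) ⟩
    ∑ⱽ (suc k) (λ p → ⟦ alt p ∧ IsInduced k G p ⟧) + #nonInducedAltPaths k G side
      ≡⟨ cong (_+ #nonInducedAltPaths k G side) (sym (count-allVecs (suc k) n λ p → alt p ∧ IsInduced k G p)) ⟩
    #inducedAltPaths k G side + #nonInducedAltPaths k G side ∎
    where
    open ≡-Reasoning
    alt : Vec (Fin n) (suc k) → Bool
    alt = IsAltPath k G side

  eAB≤ : ∀ Δ → (∀ v → deg v ≤ Δ) → eAB G side ≤ n * Δ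
  eAB≤ Δ deg≤Δ = begin
    eAB G side
      ≡⟨ trans (length-filterᵇ _ (cartesianProduct (allFin n) (allFin n))) (∑ᴸ-cartesianProduct (allFin n) (allFin n) _) ⟩
    ∑ᴸ (allFin n) (λ u → ∑ᴸ (allFin n) (λ v → ⟦ AB u v ⟧))
      ≡⟨ trans (∑ᴸ-allFin n _) (sum-cong-≗ {n} λ u → ∑ᴸ-allFin n λ v → ⟦ AB u v ⟧) ⟩
    ∑[ u < n ] ∑[ v < n ] ⟦ AB u v ⟧
      ≤⟨ sum-mono-≤ (λ u → sum-mono-≤ (λ v → AB⇒adj₁ u v)) ⟩
    ∑[ u < n ] ∑[ v < n ] ⟦ v ~₁ u ⟧
      ≡⟨ sum-cong-≗ {n} (λ u → sym (deg₁-as-sum u)) ⟩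
    ∑[ u < n ] deg u
      ≤⟨ sum-mono-≤ deg≤Δ ⟩
    ∑[ u < n ] Δ
      ≡⟨ sum-const n Δ ⟩
    n * Δ ∎
    where
    open ≤-Reasoning
    AB : Fin n → Fin n → Bool
    AB u v = side u ∧ not (side v) ∧ adj G u v
    AB⇒adj₁ : ∀ u v → ⟦ AB u v ⟧ ≤ ⟦ v ~₁ u ⟧
    AB⇒adj₁ u v with side u | side v
    ... | false | _ = z≤n
    ... | true | true = z≤n
    ... | true | false = ≤-reflexive (cong ⟦_⟧ (trans (adj-sym G u v) (sym (∧-identityʳ (adj G v u)))))

  altWalksFrom-step : ∀ m y (R : Vec (Fin n) (suc m) → Bool) →
    ∑ⱽ (suc m) (λ r → ⟦ AltWalk (y ∷ᵛ r) ∧ R r ⟧)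
      ≡ ∑[ z < n ] (⟦ y ~₁ z ⟧ * ∑ⱽ m (λ r → ⟦ AltWalk (z ∷ᵛ r) ∧ R (z ∷ᵛ r) ⟧))
  altWalksFrom-step m y R = sum-cong-≗ {n} λ z → trans
    (∑ⱽ-cong m λ r → ⟦∧∧⟧ (y ~₁ z) (AltWalk (z ∷ᵛ r)) (R (z ∷ᵛ r)))
    (sym (*-distribˡ-∑ⱽ m ⟦ y ~₁ z ⟧ λ r → ⟦ AltWalk (z ∷ᵛ r) ∧ R (z ∷ᵛ r) ⟧))

  #linkedPairs : Fin n → Fin n → ℕ
  #linkedPairs u y = ∑[ x < n ] (⟦ x ~₁ u ⟧ * ∑[ z < n ] ⟦ y ~₁ z ∧ adj G x z ⟧)

  #chordedWalks : Fin n → Fin n → ∀ L → Fin (suc L) → ℕ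
  #chordedWalks x y L j = ∑ⱽ (suc L) (λ r → ⟦ AltWalk (y ∷ᵛ r) ∧ adj G x (lookup r j) ⟧)

  linkedPairs-by-codegree : ∀ u y → #linkedPairs u y ≡ ∑[ z < n ] (⟦ y ~₁ z ⟧ * degIn G (_~₁ u) z)
  linkedPairs-by-codegree u y = begin
    ∑[ x < n ] (⟦ x ~₁ u ⟧ * ∑[ z < n ] ⟦ y ~₁ z ∧ adj G x z ⟧)
      ≡⟨ sum-cong-≗ {n} (λ x → *-distribˡ-sum ⟦ x ~₁ u ⟧ λ z → ⟦ y ~₁ z ∧ adj G x z ⟧) ⟩
    ∑[ x < n ] ∑[ z < n ] (⟦ x ~₁ u ⟧ * ⟦ y ~₁ z ∧ adj G x z ⟧)
      ≡⟨ ∑-comm (λ x z → ⟦ x ~₁ u ⟧ * ⟦ y ~₁ z ∧ adj G x z ⟧) ⟩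
    ∑[ z < n ] ∑[ x < n ] (⟦ x ~₁ u ⟧ * ⟦ y ~₁ z ∧ adj G x z ⟧)
      ≡⟨ sum-cong-≗ {n} (λ z → sum-cong-≗ {n} λ x → ⟦⟧-exchange (x ~₁ u) (y ~₁ z) (adj G x z)) ⟩
    ∑[ z < n ] ∑[ x < n ] (⟦ y ~₁ z ⟧ * ⟦ x ~₁ u ∧ adj G x z ⟧)
      ≡⟨ sum-cong-≗ {n} (λ z → sym (*-distribˡ-sum ⟦ y ~₁ z ⟧ λ x → ⟦ x ~₁ u ∧ adj G x z ⟧)) ⟩
    ∑[ z < n ] (⟦ y ~₁ z ⟧ * degIn G (_~₁ u) z) ∎
    where
    open ≡-Reasoning
    ⟦⟧-exchange : ∀ a b c → ⟦ a ⟧ * ⟦ b ∧ c ⟧ ≡ ⟦ b ⟧ * ⟦ a ∧ c ⟧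
    ⟦⟧-exchange false b c = sym (*-zeroʳ ⟦ b ⟧)
    ⟦⟧-exchange true false c = +-identityʳ _
    ⟦⟧-exchange true true c = refl

  module _ (Δ : ℕ) (deg≤Δ : ∀ v → deg v ≤ Δ) where

    ∑-adj₁≤ : ∀ y (f : Fin n → ℕ) c → (∀ z → f z ≤ c) → ∑[ z < n ] (⟦ y ~₁ z ⟧ * f z) ≤ Δ * c
    ∑-adj₁≤ y f c f≤c = begin
      ∑[ z < n ] (⟦ y ~₁ z ⟧ * f z)   ≤⟨ sum-mono-≤ (λ z → *-monoʳ-≤ ⟦ y ~₁ z ⟧ (f≤c z)) ⟩
      ∑[ z < n ] (⟦ y ~₁ z ⟧ * c)     ≡⟨ sym (*-distribʳ-sum c λ z → ⟦ y ~₁ z ⟧) ⟩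
      (∑[ z < n ] ⟦ y ~₁ z ⟧) * c     ≡⟨ cong (_* c) (sym (deg₁-as-sumʳ y)) ⟩
      deg y * c                       ≤⟨ *-monoˡ-≤ c (deg≤Δ y) ⟩
      Δ * c                           ∎
      where open ≤-Reasoning

    altWalksFrom≤ : ∀ m x → ∑ⱽ m (λ q → ⟦ AltWalk (x ∷ᵛ q) ⟧) ≤ Δ ^ m
    altWalksFrom≤ zero x = ≤-refl
    altWalksFrom≤ (suc m) x = begin
      ∑[ z < n ] ∑ⱽ m (λ q → ⟦ x ~₁ z ∧ AltWalk (z ∷ᵛ q) ⟧)
        ≡⟨ sum-cong-≗ {n} (λ z → trans (∑ⱽ-cong m λ q → ⟦∧⟧ (x ~₁ z) _) (sym (*-distribˡ-∑ⱽ m ⟦ x ~₁ z ⟧ _))) ⟩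
      ∑[ z < n ] (⟦ x ~₁ z ⟧ * ∑ⱽ m (λ q → ⟦ AltWalk (z ∷ᵛ q) ⟧))
        ≤⟨ ∑-adj₁≤ x _ (Δ ^ m) (λ z → altWalksFrom≤ m z) ⟩
      Δ ^ suc m ∎
      where open ≤-Reasoning

    prepend≤ : ∀ m (R : Vec (Fin n) (suc m) → Bool) →
      ∑[ x < n ] ∑ⱽ (suc m) (λ q → ⟦ AltWalk (x ∷ᵛ q) ∧ R q ⟧) ≤ Δ * ∑ⱽ (suc m) (λ q → ⟦ AltWalk q ∧ R q ⟧)
    prepend≤ m R = begin
      ∑[ x < n ] ∑ⱽ (suc m) (λ q → ⟦ AltWalk (x ∷ᵛ q) ∧ R q ⟧)
        ≡⟨ sum-cong-≗ {n} (λ x → altWalksFrom-step m x R) ⟩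
      ∑[ x < n ] ∑[ y < n ] (⟦ x ~₁ y ⟧ * walks y)
        ≡⟨ ∑-comm (λ x y → ⟦ x ~₁ y ⟧ * walks y) ⟩
      ∑[ y < n ] ∑[ x < n ] (⟦ x ~₁ y ⟧ * walks y)
        ≡⟨ sum-cong-≗ {n} (λ y → trans (sym (*-distribʳ-sum (walks y) λ x → ⟦ x ~₁ y ⟧)) (cong (_* walks y) (sym (deg₁-as-sum y)))) ⟩
      ∑[ y < n ] (deg y * walks y)
        ≤⟨ sum-mono-≤ (λ y → *-monoˡ-≤ (walks y) (deg≤Δ y)) ⟩
      ∑[ y < n ] (Δ * walks y)
        ≡⟨ sym (*-distribˡ-sum Δ walks) ⟩
      Δ * ∑ⱽ (suc m) (λ q → ⟦ AltWalk q ∧ R q ⟧) ∎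
      where
      open ≤-Reasoning
      walks : Fin n → ℕ
      walks y = ∑ⱽ m (λ r → ⟦ AltWalk (y ∷ᵛ r) ∧ R (y ∷ᵛ r) ⟧)

    chordedWalks-zero≤ : ∀ x y L → #chordedWalks x y L zero ≤ (∑[ z < n ] ⟦ y ~₁ z ∧ adj G x z ⟧) * Δ ^ L
    chordedWalks-zero≤ x y L = begin
      ∑[ z < n ] ∑ⱽ L (λ r → ⟦ (y ~₁ z ∧ AltWalk (z ∷ᵛ r)) ∧ adj G x z ⟧)
        ≡⟨ sum-cong-≗ {n} (λ z → trans (∑ⱽ-cong L λ r → ⟦∧⟧-swap (y ~₁ z) (AltWalk (z ∷ᵛ r)) (adj G x z))
             (sym (*-distribˡ-∑ⱽ L ⟦ y ~₁ z ∧ adj G x z ⟧ _))) ⟩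
      ∑[ z < n ] (⟦ y ~₁ z ∧ adj G x z ⟧ * ∑ⱽ L (λ r → ⟦ AltWalk (z ∷ᵛ r) ⟧))
        ≤⟨ sum-mono-≤ (λ z → *-monoʳ-≤ ⟦ y ~₁ z ∧ adj G x z ⟧ (altWalksFrom≤ L z)) ⟩
      ∑[ z < n ] (⟦ y ~₁ z ∧ adj G x z ⟧ * Δ ^ L)
        ≡⟨ sym (*-distribʳ-sum (Δ ^ L) λ z → ⟦ y ~₁ z ∧ adj G x z ⟧) ⟩
      (∑[ z < n ] ⟦ y ~₁ z ∧ adj G x z ⟧) * Δ ^ L ∎
      where
      open ≤-Reasoning
      ⟦∧⟧-swap : ∀ a w c → ⟦ (a ∧ w) ∧ c ⟧ ≡ ⟦ a ∧ c ⟧ * ⟦ w ⟧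
      ⟦∧⟧-swap false w c = refl
      ⟦∧⟧-swap true true c = sym (*-identityʳ ⟦ c ⟧)
      ⟦∧⟧-swap true false c = sym (*-zeroʳ ⟦ c ⟧)

    module _ (M Q : ℕ) (linked≤ : ∀ u y → M * #linkedPairs u y ≤ Q) where

      -- Peeling the edges of the walk between y and the chord's end one at a time, with the
      -- edge x u at the other end of the chord held fixed, reduces to counting linked pairs.
      chordedWalks≤ : ∀ L u y j → M * ∑[ x < n ] (⟦ x ~₁ u ⟧ * #chordedWalks x y L j) ≤ Q * Δ ^ L
      chordedWalks≤ L u y zero = begin
        M * ∑[ x < n ] (⟦ x ~₁ u ⟧ * #chordedWalks x y L zero)
          ≤⟨ *-monoʳ-≤ M (sum-mono-≤ λ x → *-monoʳ-≤ ⟦ x ~₁ u ⟧ (chordedWalks-zero≤ x y L)) ⟩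
        M * ∑[ x < n ] (⟦ x ~₁ u ⟧ * (links x * Δ ^ L))
          ≡⟨ cong (M *_) (trans (sum-cong-≗ {n} λ x → sym (*-assoc ⟦ x ~₁ u ⟧ (links x) (Δ ^ L)))
               (sym (*-distribʳ-sum (Δ ^ L) λ x → ⟦ x ~₁ u ⟧ * links x))) ⟩
        M * (#linkedPairs u y * Δ ^ L)
          ≡⟨ sym (*-assoc M (#linkedPairs u y) (Δ ^ L)) ⟩
        M * #linkedPairs u y * Δ ^ L
          ≤⟨ *-monoˡ-≤ (Δ ^ L) (linked≤ u y) ⟩
        Q * Δ ^ L ∎
        where
        open ≤-Reasoning
        links : Fin n → ℕ
        links x = ∑[ z < n ] ⟦ y ~₁ z ∧ adj G x z ⟧
      chordedWalks≤ (suc L) u y (suc j) = begin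
        M * ∑[ x < n ] (⟦ x ~₁ u ⟧ * #chordedWalks x y (suc L) (suc j))
          ≡⟨ cong (M *_) (sum-cong-≗ {n} λ x → cong (⟦ x ~₁ u ⟧ *_) (altWalksFrom-step (suc L) y λ r → adj G x (lookup r (suc j)))) ⟩
        M * ∑[ x < n ] (⟦ x ~₁ u ⟧ * ∑[ z < n ] (⟦ y ~₁ z ⟧ * #chordedWalks x z L j))
          ≡⟨ ∑-exchange M (λ x → ⟦ x ~₁ u ⟧) (λ z → ⟦ y ~₁ z ⟧) (λ x z → #chordedWalks x z L j) ⟩
        ∑[ z < n ] (⟦ y ~₁ z ⟧ * (M * ∑[ x < n ] (⟦ x ~₁ u ⟧ * #chordedWalks x z L j)))
          ≤⟨ ∑-adj₁≤ y _ (Q * Δ ^ L) (λ z → chordedWalks≤ L u z j) ⟩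
        Δ * (Q * Δ ^ L)
          ≡⟨ *-leftComm Δ Q (Δ ^ L) ⟩
        Q * Δ ^ suc L ∎
        where open ≤-Reasoning

      chordWalks-impossible : ∀ {m} (i j : Fin (suc m)) c → (suc (toℕ i) <ᵇ toℕ j) ≡ false →
        M * ∑ⱽ (suc m) (λ p → ⟦ AltWalk p ∧ Chord i j p ⟧) ≤ c
      chordWalks-impossible {m} i j c no-chord = ≤-trans (≤-reflexive (begin
        M * ∑ⱽ (suc m) (λ p → ⟦ AltWalk p ∧ Chord i j p ⟧)
          ≡⟨ cong (M *_) (∑ⱽ-cong (suc m) λ p → cong (λ b → ⟦ AltWalk p ∧ (b ∧ adj G (lookup p i) (lookup p j)) ⟧) no-chord) ⟩
        M * ∑ⱽ (suc m) (λ p → ⟦ AltWalk p ∧ false ⟧)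
          ≡⟨ cong (M *_) (trans (∑ⱽ-cong (suc m) λ p → cong ⟦_⟧ (∧-zeroʳ (AltWalk p))) (∑ⱽ-zero {n} (suc m))) ⟩
        M * 0
          ≡⟨ *-zeroʳ M ⟩
        0 ∎)) z≤n
        where open ≡-Reasoning

      chordWalks≤ : ∀ L (i j : Fin (3 + L)) → M * ∑ⱽ (3 + L) (λ p → ⟦ AltWalk p ∧ Chord i j p ⟧) ≤ n * Q * Δ ^ L
      chordWalks≤ L zero zero = chordWalks-impossible {2 + L} zero zero _ refl
      chordWalks≤ L zero (suc zero) = chordWalks-impossible {2 + L} zero (suc zero) _ refl
      chordWalks≤ L (suc i) zero = chordWalks-impossible {2 + L} (suc i) zero _ refl
      chordWalks≤ zero (suc i) (suc zero) = chordWalks-impossible {2} (suc i) (suc zero) _ refl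
      chordWalks≤ zero (suc i) (suc (suc zero)) = chordWalks-impossible {2} (suc i) (suc (suc zero)) _ refl
      chordWalks≤ L zero (suc (suc j)) = begin
        M * ∑[ x < n ] ∑ⱽ (2 + L) (λ q → ⟦ AltWalk (x ∷ᵛ q) ∧ adj G x (lookup q (suc j)) ⟧)
          ≡⟨ cong (M *_) (sum-cong-≗ {n} λ x → altWalksFrom-step (suc L) x λ q → adj G x (lookup q (suc j))) ⟩
        M * ∑[ x < n ] ∑[ y < n ] (⟦ x ~₁ y ⟧ * #chordedWalks x y L j)
          ≡⟨ cong (M *_) (∑-comm λ x y → ⟦ x ~₁ y ⟧ * #chordedWalks x y L j) ⟩
        M * ∑[ y < n ] ∑[ x < n ] (⟦ x ~₁ y ⟧ * #chordedWalks x y L j)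
          ≡⟨ *-distribˡ-sum M (λ y → ∑[ x < n ] (⟦ x ~₁ y ⟧ * #chordedWalks x y L j)) ⟩
        ∑[ y < n ] (M * ∑[ x < n ] (⟦ x ~₁ y ⟧ * #chordedWalks x y L j))
          ≤⟨ sum-mono-≤ (λ y → chordedWalks≤ L y y j) ⟩
        ∑[ y < n ] (Q * Δ ^ L)
          ≡⟨ trans (sum-const n (Q * Δ ^ L)) (sym (*-assoc n Q (Δ ^ L))) ⟩
        n * Q * Δ ^ L ∎
        where open ≤-Reasoning
      chordWalks≤ (suc L) (suc i) (suc j) = begin
        M * ∑[ x < n ] ∑ⱽ (3 + L) (λ q → ⟦ AltWalk (x ∷ᵛ q) ∧ Chord i j q ⟧)
          ≤⟨ *-monoʳ-≤ M (prepend≤ (2 + L) (Chord i j)) ⟩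
        M * (Δ * ∑ⱽ (3 + L) (λ q → ⟦ AltWalk q ∧ Chord i j q ⟧))
          ≡⟨ *-leftComm M Δ _ ⟩
        Δ * (M * ∑ⱽ (3 + L) (λ q → ⟦ AltWalk q ∧ Chord i j q ⟧))
          ≤⟨ *-monoʳ-≤ Δ (chordWalks≤ L i j) ⟩
        Δ * (n * Q * Δ ^ L)
          ≡⟨ *-leftComm Δ (n * Q) (Δ ^ L) ⟩
        n * Q * Δ ^ suc L ∎
        where open ≤-Reasoning

      nonInducedAltPaths≤ : ∀ L → M * #nonInducedAltPaths (2 + L) G side ≤ (3 + L) * ((3 + L) * (n * Q * Δ ^ L))
      nonInducedAltPaths≤ L = begin
        M * #nonInducedAltPaths (2 + L) G side
          ≤⟨ *-monoʳ-≤ M (∑ⱽ-mono-≤ (3 + L) (nonInduced≤chords (2 + L))) ⟩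
        M * ∑ⱽ (3 + L) (λ p → ∑[ i < 3 + L ] ∑[ j < 3 + L ] ⟦ AltWalk p ∧ Chord i j p ⟧)
          ≡⟨ cong (M *_) (trans (∑ⱽ-comm (3 + L) λ p i → ∑[ j < 3 + L ] ⟦ AltWalk p ∧ Chord i j p ⟧)
               (sum-cong-≗ {3 + L} λ i → ∑ⱽ-comm (3 + L) λ p j → ⟦ AltWalk p ∧ Chord i j p ⟧)) ⟩
        M * ∑[ i < 3 + L ] ∑[ j < 3 + L ] chordWalks i j
          ≡⟨ trans (*-distribˡ-sum M λ i → ∑[ j < 3 + L ] chordWalks i j)
               (sum-cong-≗ {3 + L} λ i → *-distribˡ-sum M (chordWalks i)) ⟩
        ∑[ i < 3 + L ] ∑[ j < 3 + L ] (M * chordWalks i j)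
          ≤⟨ sum-mono-≤ (λ i → sum-mono-≤ (λ j → chordWalks≤ L i j)) ⟩
        ∑[ i < 3 + L ] ∑[ j < 3 + L ] (n * Q * Δ ^ L)
          ≡⟨ trans (sum-cong-≗ {3 + L} λ i → sum-const (3 + L) (n * Q * Δ ^ L)) (sum-const (3 + L) ((3 + L) * (n * Q * Δ ^ L))) ⟩
        (3 + L) * ((3 + L) * (n * Q * Δ ^ L)) ∎
        where
        open ≤-Reasoning
        chordWalks : Fin (3 + L) → Fin (3 + L) → ℕ
        chordWalks i j = ∑ⱽ (3 + L) (λ p → ⟦ AltWalk p ∧ Chord i j p ⟧)

    -- Each z adjacent to y contributes its codegree with N₁(u); this is at most Δ/M unless z
    -- is heavy, and K_{s,s}-freeness leaves few heavy vertices.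
    linkedPairs≤ : ∀ {s₁} → KssFree (suc s₁) G → ∀ M .{{_ : NonZero Δ}} → 2 * M * suc s₁ ≤ Δ →
      (2 * M) ^ suc s₁ * s₁ * M ≤ Δ → ∀ u y → M * #linkedPairs u y ≤ Δ * Δ + Δ * Δ
    linkedPairs≤ {s₁} Kss-free M 2Ms≤Δ RM≤Δ u y = begin
      M * #linkedPairs u y
        ≡⟨ cong (M *_) (linkedPairs-by-codegree u y) ⟩
      M * ∑[ z < n ] (⟦ y ~₁ z ⟧ * a z)
        ≡⟨ trans (*-distribˡ-sum M λ z → ⟦ y ~₁ z ⟧ * a z) (sum-cong-≗ {n} λ z → *-leftComm M ⟦ y ~₁ z ⟧ (a z)) ⟩
      ∑[ z < n ] (⟦ y ~₁ z ⟧ * (M * a z))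
        ≤⟨ sum-mono-≤ light-or-heavy ⟩
      ∑[ z < n ] (⟦ y ~₁ z ⟧ * Δ + ⟦ heavy z ⟧ * (M * Δ))
        ≡⟨ trans (∑-distrib-+ {n} (λ z → ⟦ y ~₁ z ⟧ * Δ) (λ z → ⟦ heavy z ⟧ * (M * Δ)))
             (cong₂ _+_ (trans (sym (*-distribʳ-sum Δ λ z → ⟦ y ~₁ z ⟧)) (cong (_* Δ) (sym (deg₁-as-sumʳ y))))
                        (sym (*-distribʳ-sum (M * Δ) λ z → ⟦ heavy z ⟧))) ⟩
      deg y * Δ + (∑[ z < n ] ⟦ heavy z ⟧) * (M * Δ)
        ≤⟨ +-mono-≤ (*-monoˡ-≤ Δ (deg≤Δ y))
             (*-monoˡ-≤ (M * Δ) (heavyVertices≤ G Kss-free (_~₁ u) M Δ (≤-trans (≤-reflexive (sym (deg₁-as-sum u))) (deg≤Δ u)) 2Ms≤Δ)) ⟩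
      Δ * Δ + (2 * M) ^ suc s₁ * s₁ * (M * Δ)
        ≤⟨ +-monoʳ-≤ (Δ * Δ) (≤-trans (≤-reflexive (sym (*-assoc ((2 * M) ^ suc s₁ * s₁) M Δ))) (*-monoˡ-≤ Δ RM≤Δ)) ⟩
      Δ * Δ + Δ * Δ ∎
      where
      open ≤-Reasoning
      a : Fin n → ℕ
      a = degIn G (_~₁ u)
      heavy : Fin n → Bool
      heavy z = Δ <ᵇ M * a z
      a≤Δ : ∀ z → a z ≤ Δ
      a≤Δ z = ≤-trans (sum-mono-≤ λ x → ⟦∧⟧≤ˡ (x ~₁ u) (adj G x z))
                (≤-trans (≤-reflexive (sym (deg₁-as-sum u))) (deg≤Δ u))
        where
        ⟦∧⟧≤ˡ : ∀ b c → ⟦ b ∧ c ⟧ ≤ ⟦ b ⟧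
        ⟦∧⟧≤ˡ false c = z≤n
        ⟦∧⟧≤ˡ true c = ⟦⟧≤1 c
      light-or-heavy : ∀ z → ⟦ y ~₁ z ⟧ * (M * a z) ≤ ⟦ y ~₁ z ⟧ * Δ + ⟦ heavy z ⟧ * (M * Δ)
      light-or-heavy z with heavy z in heavy-z
      ... | false = ≤-trans (*-monoʳ-≤ ⟦ y ~₁ z ⟧ (≮⇒≥ λ Δ<Ma → subst T heavy-z (<⇒<ᵇ Δ<Ma)))
                      (≤-reflexive (sym (+-identityʳ _)))
      ... | true = ≤-trans (⟦⟧*-≤ (y ~₁ z) (M * a z)) (≤-trans (*-monoʳ-≤ M (a≤Δ z))
                      (≤-trans (m≤n+m (M * Δ) _) (+-monoʳ-≤ (⟦ y ~₁ z ⟧ * Δ) (≤-reflexive (sym (+-identityʳ (M * Δ)))))))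

  module _ (δ : ℕ) (δ≤deg : ∀ v → δ ≤ deg v) where

    freshAltWalks≥ : ∀ m → n * (δ ∸ m) ^ m ≤ ∑ⱽ (suc m) (λ p → ⟦ AltWalk p ∧ Fresh p ⟧)
    freshAltWalks≥ zero = ≤-reflexive (sym (sum-const n 1))
    freshAltWalks≥ (suc m) = begin
      n * (c * c ^ m)                                      ≡⟨ *-leftComm n c (c ^ m) ⟩
      c * (n * c ^ m)                                      ≤⟨ *-monoʳ-≤ c (*-monoʳ-≤ n (^-monoˡ-≤ m c≤δ∸m)) ⟩
      c * (n * (δ ∸ m) ^ m)                                ≤⟨ *-monoʳ-≤ c (freshAltWalks≥ m) ⟩
      c * ∑ⱽ (suc m) (λ p → ⟦ AltWalk p ∧ Fresh p ⟧)       ≤⟨ ∑ⱽ-extend {m = suc m} good good c extends ⟩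
      ∑ⱽ (2 + m) (λ p → ⟦ AltWalk p ∧ Fresh p ⟧)           ∎
      where
      open ≤-Reasoning
      c : ℕ
      c = δ ∸ suc m
      c≤δ∸m : c ≤ δ ∸ m
      c≤δ∸m = ∸-monoʳ-≤ δ (n≤1+n m)
      good : ∀ {k} → Vec (Fin n) (suc k) → Bool
      good p = AltWalk p ∧ Fresh p
      extends : ∀ q → good q ≡ true → c ≤ ∑[ x < n ] ⟦ good (x ∷ᵛ q) ⟧
      extends q@(y ∷ᵛ r) good-q with AltWalk q | Fresh q | ∧-true {AltWalk q} good-q
      ... | true | true | _ = begin
        δ ∸ suc m                               ≤⟨ ∸-monoˡ-≤ (suc m) (δ≤deg y) ⟩
        deg y ∸ suc m                           ≡⟨ cong (_∸ suc m) (deg₁-as-sum y) ⟩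
        ∑[ x < n ] ⟦ x ~₁ y ⟧ ∸ suc m           ≤⟨ count-∉ᵇ (_~₁ y) q ⟩
        ∑[ x < n ] ⟦ x ~₁ y ∧ x ∉ᵇ q ⟧          ≡⟨ sum-cong-≗ {n} (λ x → cong₂ (λ a b → ⟦ a ∧ b ⟧) (sym (∧-identityʳ (x ~₁ y))) (sym (∧-identityʳ (x ∉ᵇ q)))) ⟩
        ∑[ x < n ] ⟦ (x ~₁ y ∧ true) ∧ (x ∉ᵇ q ∧ true) ⟧ ∎

    altPaths≥ : ∀ k → 2 * k ≤ δ → n * δ ^ k ≤ 2 ^ k * #altPaths k G side
    altPaths≥ k 2k≤δ = begin
      n * δ ^ k                                              ≤⟨ *-monoʳ-≤ n (^-monoˡ-≤ k (m≤2[m∸n] δ k 2k≤δ)) ⟩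
      n * (2 * (δ ∸ k)) ^ k                                  ≡⟨ cong (n *_) (^-distribʳ-* 2 (δ ∸ k) k) ⟩
      n * (2 ^ k * (δ ∸ k) ^ k)                              ≡⟨ *-leftComm n (2 ^ k) ((δ ∸ k) ^ k) ⟩
      2 ^ k * (n * (δ ∸ k) ^ k)                              ≤⟨ *-monoʳ-≤ (2 ^ k) (freshAltWalks≥ k) ⟩
      2 ^ k * ∑ⱽ (suc k) (λ p → ⟦ AltWalk p ∧ Fresh p ⟧)     ≤⟨ *-monoʳ-≤ (2 ^ k) (∑ⱽ-mono-≤ (suc k) fresh⇒path) ⟩
      2 ^ k * ∑ⱽ (suc k) (⟦_⟧ ∘ IsAltPath k G side)           ≡⟨ cong (2 ^ k *_) (sym (count-allVecs (suc k) n (IsAltPath k G side))) ⟩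
      2 ^ k * #altPaths k G side                             ∎
      where
      open ≤-Reasoning
      fresh⇒path : ∀ p → ⟦ AltWalk p ∧ Fresh p ⟧ ≤ ⟦ IsAltPath k G side p ⟧
      fresh⇒path p with AltWalk p in walk | Fresh p in fresh
      ... | true | true = ≤-reflexive (cong ⟦_⟧ (sym (AltWalk∧Fresh⇒IsAltPath k p walk fresh)))
      ... | true | false = z≤n
      ... | false | _ = z≤n

-- A separate module, so that ℤ's prefix +_ does not make sections such as (c +_) ambiguous.
module RationalBounds where

  open import Data.Integer as ℤ using (+_; -[1+_]; +≤+; +<+)
  import Data.Integer.Properties as ℤ
  import Data.Integer.Tactic.RingSolver as ℤ-Solver
  open import Data.Rational using (mkℚ; -_; toℚᵘ)
  open import Data.Rational.Properties using (toℚᵘ-mono-≤; toℚᵘ-cancel-≤; toℚᵘ-homo-*; toℚᵘ-homo-+; toℚᵘ-homo‿-; toℚᵘ-fromℚᵘ; drop-*<*)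
  open import Data.Rational.Unnormalised as ℚᵘ using (mkℚᵘ; *≤*)
  import Data.Rational.Unnormalised.Properties as ℚᵘ

  toℚᵘ-toℚ : ∀ a → toℚᵘ (toℚ a) ℚᵘ.≃ mkℚᵘ (+ a) 0
  toℚᵘ-toℚ a = toℚᵘ-fromℚᵘ (mkℚᵘ (+ a) 0)

  natFactor : ∀ K → 0ℚ <ℚ K → Σ ℕ λ K′ → 1 ≤ K′ × (∀ a b → toℚ a ≤ℚ K *ℚ toℚ b → a ≤ K′ * b)
  natFactor K@(mkℚ (+ p) q _) _ = suc p , s≤s z≤n , λ a b a≤Kb →
    ≤-trans (m≤m*n a (suc (q * 1))) (≤-trans (cross-multiply a b (toℚᵘ-≤ a b a≤Kb)) (m≤n+m (p * b) b))
    where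
    toℚᵘ-≤ : ∀ a b → toℚ a ≤ℚ K *ℚ toℚ b → mkℚᵘ (+ a) 0 ℚᵘ.≤ mkℚᵘ (+ p) q ℚᵘ.* mkℚᵘ (+ b) 0
    toℚᵘ-≤ a b a≤Kb = ℚᵘ.≤-respˡ-≃ (toℚᵘ-toℚ a)
      (ℚᵘ.≤-respʳ-≃ (ℚᵘ.≃-trans (toℚᵘ-homo-* K (toℚ b)) (ℚᵘ.*-congˡ {toℚᵘ K} (toℚᵘ-toℚ b))) (toℚᵘ-mono-≤ a≤Kb))
    cross-multiply : ∀ a b → mkℚᵘ (+ a) 0 ℚᵘ.≤ mkℚᵘ (+ p) q ℚᵘ.* mkℚᵘ (+ b) 0 → a * suc (q * 1) ≤ p * b
    cross-multiply a b (*≤* a≤pb) = ℤ.drop‿+≤+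
      (subst₂ ℤ._≤_ (sym (ℤ.pos-* a _)) (trans (ℤ.*-identityʳ (+ p ℤ.* + b)) (sym (ℤ.pos-* p b))) a≤pb)
  natFactor (mkℚ -[1+ _ ] _ _) 0<K with drop-*<* 0<K
  ... | ()

  -- With ε = (1 + e) / (1 + f) in lowest terms, N = 1 + f works since 1 / N ≤ ε.
  fractionBound : ∀ ε → 0ℚ <ℚ ε →
    Σ ℕ λ N → (∀ A I B → A ≡ I + B → N * B ≤ A → (1ℚ - ε) *ℚ toℚ A ≤ℚ toℚ I)
  fractionBound (mkℚ (+ zero) _ _) 0<ε with drop-*<* 0<ε
  ... | +<+ ()
  fractionBound (mkℚ -[1+ _ ] _ _) 0<ε with drop-*<* 0<ε
  ... | ()
  fractionBound ε@(mkℚ (+ suc e) f _) _ = suc f , λ A I B A≡I+B NB≤A →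
    toℚᵘ-cancel-≤ (ℚᵘ.≤-respˡ-≃ (ℚᵘ.≃-sym (toℚᵘ-lhs A)) (ℚᵘ.≤-respʳ-≃ (ℚᵘ.≃-sym (toℚᵘ-toℚ I))
      (ℚᵘ-bound A I (fA≤NI A I B A≡I+B NB≤A))))
    where
    toℚᵘ-lhs : ∀ A → toℚᵘ ((1ℚ - ε) *ℚ toℚ A) ℚᵘ.≃ (mkℚᵘ (+ 1) 0 ℚᵘ.+ mkℚᵘ -[1+ e ] f) ℚᵘ.* mkℚᵘ (+ A) 0
    toℚᵘ-lhs A = ℚᵘ.≃-trans (toℚᵘ-homo-* (1ℚ - ε) (toℚ A))
      (ℚᵘ.*-cong (ℚᵘ.≃-trans (toℚᵘ-homo-+ 1ℚ (- ε)) (ℚᵘ.+-congʳ (toℚᵘ 1ℚ) (toℚᵘ-homo‿- ε))) (toℚᵘ-toℚ A))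
    fA≤NI : ∀ A I B → A ≡ I + B → suc f * B ≤ A → f * A ≤ suc f * I
    fA≤NI A I B A≡I+B NB≤A = +-cancelˡ-≤ A (f * A) (suc f * I) (begin
      A + f * A              ≡⟨ trans (cong (suc f *_) A≡I+B) (*-distribˡ-+ (suc f) I B) ⟩
      suc f * I + suc f * B  ≤⟨ +-monoʳ-≤ (suc f * I) NB≤A ⟩
      suc f * I + A          ≡⟨ +-comm (suc f * I) A ⟩
      A + suc f * I          ∎)
      where open ≤-Reasoning
    ring : ∀ F E X → ((+ 1 ℤ.* (+ 1 ℤ.+ F) ℤ.+ ℤ.- (+ 1 ℤ.+ E) ℤ.* + 1) ℤ.* X) ℤ.* + 1 ≡ F ℤ.* X ℤ.- E ℤ.* X
    ring = ℤ-Solver.solve-∀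
    ℚᵘ-bound : ∀ A I → f * A ≤ suc f * I → (mkℚᵘ (+ 1) 0 ℚᵘ.+ mkℚᵘ -[1+ e ] f) ℚᵘ.* mkℚᵘ (+ A) 0 ℚᵘ.≤ mkℚᵘ (+ I) 0
    ℚᵘ-bound A I fA≤NI = *≤* (begin
      ((+ 1 ℤ.* + suc f ℤ.+ -[1+ e ] ℤ.* + 1) ℤ.* + A) ℤ.* + 1
        ≡⟨ cong₂ (λ u v → ((+ 1 ℤ.* u ℤ.+ v ℤ.* + 1) ℤ.* + A) ℤ.* + 1) (ℤ.pos-+ 1 f) (cong ℤ.-_ (ℤ.pos-+ 1 e)) ⟩
      ((+ 1 ℤ.* (+ 1 ℤ.+ + f) ℤ.+ ℤ.- (+ 1 ℤ.+ + e) ℤ.* + 1) ℤ.* + A) ℤ.* + 1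
        ≡⟨ trans (ring (+ f) (+ e) (+ A)) (cong (λ w → + f ℤ.* + A ℤ.- w) (sym (ℤ.pos-* e A))) ⟩
      + f ℤ.* + A ℤ.- + (e * A)
        ≤⟨ ℤ.i-j≤i (+ f ℤ.* + A) (+ (e * A)) ⟩
      + f ℤ.* + A
        ≡⟨ sym (ℤ.pos-* f A) ⟩
      + (f * A)
        ≤⟨ +≤+ fA≤NI ⟩
      + (suc f * I)
        ≡⟨ trans (ℤ.pos-* (suc f) I) (trans (ℤ.*-comm (+ suc f) (+ I)) (cong (λ w → + I ℤ.* + suc w) (sym (trans (*-identityʳ (f + 0)) (+-identityʳ f))))) ⟩
      + I ℤ.* + suc ((f + 0) * 1) ∎)
      where open ℤ.≤-Reasoning

open RationalBounds using (natFactor; fractionBound)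

module _ {n} (G : Graph n) (side : Partition n) where

  private
    deg : Fin n → ℕ
    deg = deg₁ G side

  dense⇒minDegree≥ : ∀ k K′ D δ → .{{NonZero K′}} → 0 < n → (K′ * D) ^ suc k * n ^ suc (suc k) ≤ eAB G side ^ suc k →
    (∀ v → deg v ≤ K′ * δ) → D ≤ δ
  dense⇒minDegree≥ k K′ D δ 0<n dense deg≤Δ = *-cancelˡ-≤ K′ (^-cancelʳ-≤ k (K′ * D) (K′ * δ)
    (≤-trans (m≤m*n (C ^ suc k) n {{>-nonZero 0<n}}) (*-cancelʳ-≤ (C ^ suc k * n) (Δ ^ suc k) (n ^ suc k) {{m^n≢0 n (suc k) {{>-nonZero 0<n}}}} (begin
      C ^ suc k * n * n ^ suc k            ≡⟨ *-assoc (C ^ suc k) n (n ^ suc k) ⟩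
      C ^ suc k * n ^ suc (suc k)          ≤⟨ dense ⟩
      eAB G side ^ suc k                   ≤⟨ ^-monoˡ-≤ (suc k) (eAB≤ G side Δ deg≤Δ) ⟩
      (n * Δ) ^ suc k                      ≡⟨ trans (^-distribʳ-* n Δ (suc k)) (*-comm (n ^ suc k) (Δ ^ suc k)) ⟩
      Δ ^ suc k * n ^ suc k                ∎))))
    where
    open ≤-Reasoning
    C : ℕ
    C = K′ * D
    Δ : ℕ
    Δ = K′ * δ

minimiser : ∀ {n} (f : Fin (suc n) → ℕ) → Σ (Fin (suc n)) λ v₀ → ∀ v → f v₀ ≤ f v
minimiser {n} f = argmin f zero (allFin (suc n)) , λ v → All.lookup (f[argmin]≤f[xs] {f = f} zero (allFin (suc n))) (∈-allFin v)

degreeWindow : ∀ {n} (G : Graph n) (side : Partition n) k K K′ D .{{_ : NonZero K′}} →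
  (∀ a b → toℚ a ≤ℚ K *ℚ toℚ b → a ≤ K′ * b) →
  (K′ * D) ^ suc k * n ^ suc (suc k) ≤ eAB G side ^ suc k → AlmostRegular K G side →
  Σ ℕ λ δ → D ≤ δ × (∀ v → δ ≤ deg₁ G side v) × (∀ v → deg₁ G side v ≤ K′ * δ)
degreeWindow {zero} G side k K K′ D K-factor dense regular = D , ≤-refl , (λ ()) , (λ ())
degreeWindow {suc n} G side k K K′ D K-factor dense regular =
  deg v₀ , dense⇒minDegree≥ G side k K′ D (deg v₀) z<s dense deg≤Δ , δ≤deg , deg≤Δ
  where
  deg : Fin (suc n) → ℕ
  deg = deg₁ G side
  v₀ : Fin (suc n)
  v₀ = proj₁ (minimiser deg)
  δ≤deg : ∀ v → deg v₀ ≤ deg v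
  δ≤deg = proj₂ (minimiser deg)
  deg≤Δ : ∀ v → deg v ≤ K′ * deg v₀
  deg≤Δ v = K-factor (deg v) (deg v₀) (regular v v₀)

-- (k+1)² chord positions, the factor 2 of linkedPairs≤, Δ^k = K′^k δ^k and δ^k ≤ 2^k (δ − k)^k.
coefficient : ℕ → ℕ → ℕ
coefficient L K′ = (3 + L) * (3 + L) * 2 * (K′ ^ (2 + L) * 2 ^ (2 + L))

fewNonInducedAltPaths : ∀ {n} (G : Graph n) (side : Partition n) L s₁ K′ N .{{_ : NonZero K′}} →
  KssFree (suc s₁) G → ∀ δ → let M = coefficient L K′ * N in
  2 * M * suc s₁ ≤ δ → (2 * M) ^ suc s₁ * s₁ * M ≤ δ → 2 * (2 + L) ≤ δ → 0 < δ →
  (∀ v → δ ≤ deg₁ G side v) → (∀ v → deg₁ G side v ≤ K′ * δ) →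
  N * #nonInducedAltPaths (2 + L) G side ≤ #altPaths (2 + L) G side
fewNonInducedAltPaths {n} G side L s₁ K′ N Kss-free δ 2Ms≤δ RM≤δ 2k≤δ 0<δ δ≤deg deg≤Δ =
  *-cancelˡ-≤ c₀ {{c₀≢0}} (begin
    c₀ * (N * bad)
      ≡⟨ sym (*-assoc c₀ N bad) ⟩
    M * bad
      ≤⟨ nonInducedAltPaths≤ G side Δ deg≤Δ M (Δ * Δ + Δ * Δ)
           (linkedPairs≤ G side Δ deg≤Δ Kss-free M {{>-nonZero (≤-Δ 0<δ)}} (≤-Δ 2Ms≤δ) (≤-Δ RM≤δ)) L ⟩
    (3 + L) * ((3 + L) * (n * (Δ * Δ + Δ * Δ) * Δ ^ L))
      ≡⟨ trans (collect (3 + L) n Δ (Δ ^ L)) (cong (λ x → (3 + L) * (3 + L) * 2 * (n * x)) (^-distribʳ-* K′ δ k)) ⟩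
    (3 + L) * (3 + L) * 2 * (n * (K′ ^ k * δ ^ k))
      ≡⟨ swap ((3 + L) * (3 + L) * 2) n (K′ ^ k) (δ ^ k) ⟩
    (3 + L) * (3 + L) * 2 * K′ ^ k * (n * δ ^ k)
      ≤⟨ *-monoʳ-≤ ((3 + L) * (3 + L) * 2 * K′ ^ k) (altPaths≥ G side δ δ≤deg k 2k≤δ) ⟩
    (3 + L) * (3 + L) * 2 * K′ ^ k * (2 ^ k * #altPaths k G side)
      ≡⟨ regroup ((3 + L) * (3 + L) * 2) (K′ ^ k) (2 ^ k) (#altPaths k G side) ⟩
    c₀ * #altPaths k G side ∎)
  where
  open ≤-Reasoning
  k : ℕ
  k = 2 + L
  c₀ : ℕ
  c₀ = coefficient L K′
  M : ℕ
  M = c₀ * N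
  Δ : ℕ
  Δ = K′ * δ
  bad : ℕ
  bad = #nonInducedAltPaths k G side
  collect : ∀ t n Δ X → t * (t * (n * (Δ * Δ + Δ * Δ) * X)) ≡ t * t * 2 * (n * (Δ * (Δ * X)))
  collect = solve-∀
  swap : ∀ c n a b → c * (n * (a * b)) ≡ c * a * (n * b)
  swap = solve-∀
  regroup : ∀ c a b A → c * a * (b * A) ≡ c * (a * b) * A
  regroup = solve-∀
  ≤-Δ : ∀ {a} → a ≤ δ → a ≤ Δ
  ≤-Δ a≤δ = ≤-trans a≤δ (m≤n*m δ K′)
  c₀≢0 : NonZero c₀
  c₀≢0 = m*n≢0 ((3 + L) * (3 + L) * 2) (K′ ^ k * 2 ^ k) {{_}} {{m*n≢0 (K′ ^ k) (2 ^ k) {{m^n≢0 K′ k}} {{m^n≢0 2 k}}}}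

lemma4p7 : (k s : ℕ) → 2 ≤ k → 2 ≤ s → (K ε : ℚ) → 0ℚ <ℚ K → 0ℚ <ℚ ε →
    Σ ℕ λ C → 0 < C ×
      (∀ (n : ℕ) (G : Graph n) (side : Partition n) →
        KssFree s G →
        C ^ k * n ^ (suc k) ≤ eAB G side ^ k →
        AlmostRegular K G side →
        (1ℚ - ε) *ℚ toℚ (#altPaths k G side) ≤ℚ toℚ (#inducedAltPaths k G side))
lemma4p7 (suc (suc L)) (suc s₁) (s≤s (s≤s z≤n)) (s≤s (s≤s z≤n)) K ε 0<K 0<ε =
  K′ * D₀ , *-mono-≤ 1≤K′ (m≤n+m 1 _) , λ n G side Kss-free dense regular →
    let δ , D₀≤δ , δ≤deg , deg≤Δ = degreeWindow G side (suc L) K K′ D₀ {{K′≢0}} K-factor dense regular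
        2Ms≤δ , RM≤δ , 2k≤δ , 0<δ = summands≤ _ _ _ D₀≤δ
    in ε-slack _ _ _ (#altPaths-split G side (2 + L))
         (fewNonInducedAltPaths G side L s₁ K′ N {{K′≢0}} Kss-free δ 2Ms≤δ RM≤δ 2k≤δ 0<δ δ≤deg deg≤Δ)
  where
  K′ : ℕ
  K′ = proj₁ (natFactor K 0<K)
  1≤K′ : 1 ≤ K′
  1≤K′ = proj₁ (proj₂ (natFactor K 0<K))
  K-factor : ∀ a b → toℚ a ≤ℚ K *ℚ toℚ b → a ≤ K′ * b
  K-factor = proj₂ (proj₂ (natFactor K 0<K))
  K′≢0 : NonZero K′
  K′≢0 = >-nonZero 1≤K′
  N : ℕ
  N = proj₁ (fractionBound ε 0<ε)
  ε-slack : ∀ A I B → A ≡ I + B → N * B ≤ A → (1ℚ - ε) *ℚ toℚ A ≤ℚ toℚ I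
  ε-slack = proj₂ (fractionBound ε 0<ε)
  M : ℕ
  M = coefficient L K′ * N
  D₀ : ℕ
  D₀ = 2 * M * suc s₁ + (2 * M) ^ suc s₁ * s₁ * M + 2 * (2 + L) + 1
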